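{- Let $D=(V,E)$ be a simple $r$-regular digraph with $n$ vertices and $m$ arcs. Then, as an identity of rational functions in $\lambda$, $$A( \lambda , D^{11+}) = (\lambda + 1)^{m-n}\, \frac{(\lambda + 1)^2 - r - n((\lambda + 1)(r + 1) - m)}{(\lambda + 1)^2 - r}\, A((\lambda + 1)^2, D).$$
   Context: A simple digraph is $D=(V,E)$ with $V$ finite nonempty and $E\subseteq\{(u,v)\in V\times V: u\neq v\}$; for an arc $e=(u,v)$, $t(e)=u$ and $h(e)=v$. $D$ is $r$-regular if every vertex has in-degree and out-degree $r$. $A(\lambda,G)=\det(\lambda I-A(G))$ with $A(G)$ the 0/1 adjacency matrix. $D^{11+}$ is the digraph on vertex set $V\cup E$ (disjoint union) whose arcs are: all $(u,v)$ with $u,v\in V$, $u\neq v$; all $(p,q)$ with $p,q\in E$, $p\neq q$; all $(v,e)$ with $v\in V$, $e\in E$, $v=t(e)$; and all $(e,v)$ with $e\in E$, $v\in V$, $v=h(e)$. -}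

module Defs where

open import Level using (Level)
open import Data.Nat as ℕ using (ℕ; zero; suc)
open import Data.Fin as Fin using (Fin; zero; suc; punchIn; splitAt; toℕ)
open import Data.Fin.Properties using (_≟_)
open import Data.Sum using (_⊎_; inj₁; inj₂)
open import Data.Bool using (Bool; true; false; if_then_else_; not)
open import Relation.Nullary.Decidable using (⌊_⌋)
open import Relation.Nullary using (¬_)
open import Relation.Binary.PropositionalEquality using (_≡_)
open import Data.Product using (Σ; _×_)
open import Algebra.Bundles using (CommutativeRing)

-- Simple digraphs with V = Fin n and an enumeration E ≅ Fin m of the arcs.
-- tl / hd are t and h; no loops; no parallel arcs (the arc set is a subset
-- of V × V, so distinct arcs have distinct (tail, head) pairs).

record Digraph : Set where
  field
    n  : ℕ
    m  : ℕ
    tl : Fin m → Fin n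
    hd : Fin m → Fin n
    nonempty : 0 ℕ.< n
    noLoop   : ∀ e → ¬ (tl e ≡ hd e)
    simple   : ∀ e f → tl e ≡ tl f → hd e ≡ hd f → e ≡ f
open Digraph public

countFin : ∀ {k} → (Fin k → Bool) → ℕ
countFin {zero}  p = 0
countFin {suc k} p = (if p zero then 1 else 0) ℕ.+ countFin (λ i → p (suc i))

anyFin : ∀ {k} → (Fin k → Bool) → Bool
anyFin {zero}  p = false
anyFin {suc k} p = if p zero then true else anyFin (λ i → p (suc i))

_==_ : ∀ {k} → Fin k → Fin k → Bool
a == b = ⌊ a ≟ b ⌋

outdeg indeg : (D : Digraph) → Fin (n D) → ℕ
outdeg D v = countFin (λ e → tl D e == v)
indeg  D v = countFin (λ e → hd D e == v)

Regular : ℕ → Digraph → Set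
Regular r D = ∀ v → (outdeg D v ≡ r) × (indeg D v ≡ r)

adj : (D : Digraph) → Fin (n D) → Fin (n D) → Bool
adj D u v = anyFin (λ e → if tl D e == u then hd D e == v else false)

-- D^{11+} on vertex set V ⊔ E, encoded as Fin (n + m) via splitAt
adj11 : (D : Digraph) → Fin (n D ℕ.+ m D) → Fin (n D ℕ.+ m D) → Bool
adj11 D a b with splitAt (n D) a | splitAt (n D) b
... | inj₁ u | inj₁ v = not (u == v)
... | inj₂ p | inj₂ q = not (p == q)
... | inj₁ v | inj₂ e = tl D e == v
... | inj₂ e | inj₁ v = hd D e == v

-- Determinants over an arbitrary commutative ring (Laplace expansion
-- along the first row), and A(λ, G) = det(λ I - A(G)).

module RingDefs {c ℓ : Level} (R : CommutativeRing c ℓ) where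
  open CommutativeRing R using (Carrier; _+_; _*_; -_; _-_; 0#; 1#)

  fromℕ : ℕ → Carrier
  fromℕ zero    = 0#
  fromℕ (suc k) = 1# + fromℕ k

  pow : Carrier → ℕ → Carrier
  pow x zero    = 1#
  pow x (suc k) = x * pow x k

  sumFin : ∀ {k} → (Fin k → Carrier) → Carrier
  sumFin {zero}  f = 0#
  sumFin {suc k} f = f zero + sumFin (λ i → f (suc i))

  sign : ℕ → Carrier
  sign zero    = 1#
  sign (suc k) = - sign k

  det : ∀ {k} → (Fin k → Fin k → Carrier) → Carrier
  det {zero}  M = 1#
  det {suc k} M =
    sumFin (λ j → sign (toℕ j) * (M zero j * det (λ a b → M (suc a) (punchIn j b))))

  fromBool : Bool → Carrier
  fromBool true  = 1#
  fromBool false = 0#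

  charPoly : ∀ {k} → (Fin k → Fin k → Bool) → Carrier → Carrier
  charPoly A x = det (λ a b → (if a == b then x else 0#) - fromBool (A a b))

module Submission where

-- Order the vertices of D^{11+} as V ⊔ E and put y = x + 1.  With J the
-- all-ones matrix, T_{ve} = [t(e) = v] and H_{ev} = [h(e) = v],
--     xI - A(D^{11+}) = [ yI - J    -T   ]
--                       [   -H    yI - J ].
-- Subtracting all vertex rows from every arc row turns the arc block into
-- yI (each arc has one tail), and the Schur complement of this scalar
-- block gives  y^n A(x, D^{11+}) = y^m det S  with
--     S = y (yI - J) + T (-H + (n - y) J) = tI - A(D) - cJ,
-- t = y², c = y (r + 1) - m, by TH = A(D), TJ = rJ and m = nr.  Both
-- tI - A(D) and S have constant column sums (t - r and t - r - nc), and a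
-- matrix whose columns all sum to σ has determinant σ·det(the matrix with
-- one row replaced by ones); for tI - A(D) and S these last determinants
-- agree, which yields the theorem after multiplying by t - r.

open import Defs
open import Level using (Level; _⊔_)
open import Data.Nat as ℕ using (ℕ; zero; suc)
import Data.Nat.Properties as ℕP
open import Data.Fin using (Fin; zero; suc; punchIn; punchOut; toℕ; _↑ˡ_; _↑ʳ_; splitAt; join; fromℕ<)
import Data.Fin.Properties as FinP
open import Data.Bool using (Bool; true; false; if_then_else_; not)
open import Data.Sum using (_⊎_; inj₁; inj₂)
open import Data.Product using (_×_; _,_; proj₁; proj₂)
open import Data.Empty using (⊥-elim)
open import Function using (_∘_)
open import Data.Maybe using (Maybe; just; nothing)
open import Data.Integer as ℤ using (ℤ; +_; -[1+_])
import Data.Integer.Properties as ℤP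
open import Data.Sign as Sign using (Sign)
open import Relation.Binary.PropositionalEquality as ≡ using (_≡_; _≢_)
open import Relation.Nullary using (yes; no; Dec; does)
open import Relation.Nullary.Decidable using (dec-true; dec-false)
open import Data.Fin.Permutation.Components using (transpose)
open import Algebra.Bundles using (CommutativeRing; RawRing)
open import Algebra.Solver.Ring.AlmostCommutativeRing using (_-Raw-AlmostCommutative⟶_; fromCommutativeRing)

==-refl : ∀ {k} (i : Fin k) → (i == i) ≡ true
==-refl i with i FinP.≟ i
... | yes _  = ≡.refl
... | no i≢i = ⊥-elim (i≢i ≡.refl)

==-false : ∀ {k} {i j : Fin k} → i ≢ j → (i == j) ≡ false
==-false {i = i} {j} i≢j with i FinP.≟ j
... | yes i≡j = ⊥-elim (i≢j i≡j)
... | no _    = ≡.refl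

==-sound : ∀ {k} {i j : Fin k} → (i == j) ≡ true → i ≡ j
==-sound {i = i} {j} h with i FinP.≟ j
... | yes i≡j = i≡j

==-sym : ∀ {k} (i j : Fin k) → (i == j) ≡ (j == i)
==-sym i j with i FinP.≟ j
... | yes ≡.refl = ≡.sym (==-refl i)
... | no i≢j     = ≡.sym (==-false (i≢j ∘ ≡.sym))

==-injective : ∀ {k l} (f : Fin k → Fin l) → (∀ {a b} → f a ≡ f b → a ≡ b) → ∀ a b → (f a == f b) ≡ (a == b)
==-injective f f-injective a b with a FinP.≟ b
... | yes ≡.refl = ==-refl (f a)
... | no a≢b     = ==-false (a≢b ∘ f-injective)

↑ˡ≢↑ʳ : ∀ {a b} (u : Fin a) (e : Fin b) → u ↑ˡ b ≢ a ↑ʳ e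
↑ˡ≢↑ʳ {a} {b} u e eq with ≡.trans (≡.sym (FinP.splitAt-↑ˡ a u b)) (≡.trans (≡.cong (splitAt a) eq) (FinP.splitAt-↑ʳ a b e))
... | ()

-- The boolean order m <ᵇ t marks the rows already processed in an
-- induction over the rows of a matrix.

<ᵇ-true : ∀ {m n} → m ℕ.< n → (m ℕ.<ᵇ n) ≡ true
<ᵇ-true {zero}  {suc n} _             = ≡.refl
<ᵇ-true {suc m} {suc n} (ℕ.s≤s m<n) = <ᵇ-true m<n

<ᵇ-irrefl : ∀ n → (n ℕ.<ᵇ n) ≡ false
<ᵇ-irrefl zero    = ≡.refl
<ᵇ-irrefl (suc n) = <ᵇ-irrefl n

<ᵇ-suc : ∀ {m t} → m ≢ t → (m ℕ.<ᵇ suc t) ≡ (m ℕ.<ᵇ t)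
<ᵇ-suc {zero}  {zero}  0≢0 = ⊥-elim (0≢0 ≡.refl)
<ᵇ-suc {zero}  {suc t} _   = ≡.refl
<ᵇ-suc {suc m} {zero}  _   = ≡.refl
<ᵇ-suc {suc m} {suc t} m≢t = <ᵇ-suc (m≢t ∘ ≡.cong suc)

transpose-at-i : ∀ {k} (i j : Fin k) → transpose i j i ≡ j
transpose-at-i i j rewrite dec-true (i FinP.≟ i) ≡.refl = ≡.refl

transpose-at-j : ∀ {k} (i j : Fin k) → transpose i j j ≡ i
transpose-at-j i j with j FinP.≟ i
... | yes j≡i = j≡i
... | no _ rewrite dec-true (j FinP.≟ j) ≡.refl = ≡.refl

transpose-other : ∀ {k} (i j : Fin k) {l} → l ≢ i → l ≢ j → transpose i j l ≡ l
transpose-other i j {l} l≢i l≢j rewrite dec-false (l FinP.≟ i) l≢i | dec-false (l FinP.≟ j) l≢j = ≡.refl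

transpose-suc : ∀ {k} (i j l : Fin k) → transpose (suc i) (suc j) (suc l) ≡ suc (transpose i j l)
transpose-suc i j l with does (l FinP.≟ i)
... | true  = ≡.refl
... | false with does (l FinP.≟ j)
...   | true  = ≡.refl
...   | false = ≡.refl

-- Two lemmas about removing two distinct columns i, j from Fin (2 + k):
-- removing i then (the image of) j gives the same embedding as removing j
-- then i, and the two orders of removal have opposite parity.

punchIn-commute : ∀ {k} (i j : Fin (suc (suc k))) (i≢j : i ≢ j) (j≢i : j ≢ i) (b : Fin k) →
  punchIn i (punchIn (punchOut i≢j) b) ≡ punchIn j (punchIn (punchOut j≢i) b)
punchIn-commute zero    zero    i≢j _ b = ⊥-elim (i≢j ≡.refl)
punchIn-commute zero    (suc j) _   _ b = ≡.refl
punchIn-commute (suc i) zero    _   _ b = ≡.refl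
punchIn-commute {zero}  (suc zero) (suc zero) i≢j _ b = ⊥-elim (i≢j ≡.refl)
punchIn-commute {suc k} (suc i) (suc j) i≢j j≢i zero    = ≡.refl
punchIn-commute {suc k} (suc i) (suc j) i≢j j≢i (suc b) =
  ≡.cong suc (punchIn-commute i j (i≢j ∘ ≡.cong suc) (j≢i ∘ ≡.cong suc) b)

suc-shift : ∀ {a b c d} → suc (a ℕ.+ b) ≡ c ℕ.+ d → suc (suc a ℕ.+ suc b) ≡ suc c ℕ.+ suc d
suc-shift {a} {b} {c} {d} eq =
  ≡.trans (≡.cong (λ n → suc (suc n)) (≡.trans (ℕP.+-suc a b) eq)) (≡.sym (≡.cong suc (ℕP.+-suc c d)))

punchOut-parity : ∀ {k} (i j : Fin (suc (suc k))) (i≢j : i ≢ j) (j≢i : j ≢ i) →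
  suc (toℕ i ℕ.+ toℕ (punchOut i≢j)) ≡ toℕ j ℕ.+ toℕ (punchOut j≢i) ⊎
  suc (toℕ j ℕ.+ toℕ (punchOut j≢i)) ≡ toℕ i ℕ.+ toℕ (punchOut i≢j)
punchOut-parity zero    zero    i≢j _ = ⊥-elim (i≢j ≡.refl)
punchOut-parity zero    (suc j) _   _ = inj₁ (≡.cong suc (≡.sym (ℕP.+-identityʳ (toℕ j))))
punchOut-parity (suc i) zero    _   _ = inj₂ (≡.cong suc (≡.sym (ℕP.+-identityʳ (toℕ i))))
punchOut-parity {zero}  (suc zero) (suc zero) i≢j _ = ⊥-elim (i≢j ≡.refl)
punchOut-parity {suc k} (suc i) (suc j) i≢j j≢i
  with punchOut-parity i j (i≢j ∘ ≡.cong suc) (j≢i ∘ ≡.cong suc)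
... | inj₁ eq = inj₁ (suc-shift eq)
... | inj₂ eq = inj₂ (suc-shift eq)

-- Integer coefficients for the ring solver: the canonical map ℤ → R is
-- a ring homomorphism, so 'Algebra.Solver.Ring' decides ring identities
-- in R by normalising polynomials with (computable) integer coefficients.

module IntegerSolver {c ℓ} (R : CommutativeRing c ℓ) where
  open CommutativeRing R hiding (zero)
  open import Algebra.Properties.Ring ring using (-‿distribˡ-*; -‿distribʳ-*; -‿involutive; -0#≈0#; -‿+-comm)
  open import Algebra.Properties.Monoid.Mult.TCOptimised +-monoid using (×-homo-+; 1+×) renaming (_×_ to _·_)
  open import Algebra.Properties.Semiring.Mult.TCOptimised semiring using (×1-homo-*)
  open import Relation.Binary.Reasoning.Setoid setoid

  ⟦_⟧ℕ : ℕ → Carrier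
  ⟦ n ⟧ℕ = n · 1#

  ⟦_⟧ℤ : ℤ → Carrier
  ⟦ + n ⟧ℤ      = ⟦ n ⟧ℕ
  ⟦ -[1+ n ] ⟧ℤ = - ⟦ suc n ⟧ℕ

  ⊖-homo : ∀ m n → ⟦ m ℤ.⊖ n ⟧ℤ ≈ ⟦ m ⟧ℕ - ⟦ n ⟧ℕ
  ⊖-homo zero    zero    = sym (-‿inverseʳ 0#)
  ⊖-homo zero    (suc n) = sym (+-identityˡ _)
  ⊖-homo (suc m) zero    = sym (trans (+-cong refl -0#≈0#) (+-identityʳ _))
  ⊖-homo (suc m) (suc n) = begin
    ⟦ suc m ℤ.⊖ suc n ⟧ℤ             ≡⟨ ≡.cong ⟦_⟧ℤ (ℤP.[1+m]⊖[1+n]≡m⊖n m n) ⟩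
    ⟦ m ℤ.⊖ n ⟧ℤ                     ≈⟨ ⊖-homo m n ⟩
    ⟦ m ⟧ℕ - ⟦ n ⟧ℕ                   ≈⟨ +-congʳ (+-identityˡ _) ⟨
    (0# + ⟦ m ⟧ℕ) - ⟦ n ⟧ℕ            ≈⟨ +-congʳ (+-congʳ (-‿inverseʳ 1#)) ⟨
    ((1# - 1#) + ⟦ m ⟧ℕ) - ⟦ n ⟧ℕ     ≈⟨ +-congʳ (+-assoc 1# (- 1#) _) ⟩
    (1# + (- 1# + ⟦ m ⟧ℕ)) - ⟦ n ⟧ℕ   ≈⟨ +-congʳ (+-congˡ (+-comm (- 1#) _)) ⟩
    (1# + (⟦ m ⟧ℕ - 1#)) - ⟦ n ⟧ℕ     ≈⟨ +-congʳ (+-assoc 1# _ _) ⟨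
    ((1# + ⟦ m ⟧ℕ) - 1#) - ⟦ n ⟧ℕ     ≈⟨ +-assoc _ (- 1#) _ ⟩
    (1# + ⟦ m ⟧ℕ) + (- 1# - ⟦ n ⟧ℕ)   ≈⟨ +-cong (1+× m 1#) (trans (-‿cong (1+× n 1#)) (sym (-‿+-comm 1# _))) ⟨
    ⟦ suc m ⟧ℕ - ⟦ suc n ⟧ℕ           ∎

  sg : Sign → Carrier → Carrier
  sg Sign.+ a = a
  sg Sign.- a = - a

  ◃-homo : ∀ s n → ⟦ s ℤ.◃ n ⟧ℤ ≈ sg s ⟦ n ⟧ℕ
  ◃-homo Sign.+ zero    = refl
  ◃-homo Sign.- zero    = sym -0#≈0#
  ◃-homo Sign.+ (suc n) = refl
  ◃-homo Sign.- (suc n) = refl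

  +-homo : ∀ i j → ⟦ i ℤ.+ j ⟧ℤ ≈ ⟦ i ⟧ℤ + ⟦ j ⟧ℤ
  +-homo (+ m)    (+ n)    = ×-homo-+ 1# m n
  +-homo (+ m)    -[1+ n ] = ⊖-homo m (suc n)
  +-homo -[1+ m ] (+ n)    = trans (⊖-homo n (suc m)) (+-comm _ _)
  +-homo -[1+ m ] -[1+ n ] = begin
    - ⟦ suc (suc (m ℕ.+ n)) ⟧ℕ        ≡⟨ ≡.cong (λ k → - ⟦ suc k ⟧ℕ) (ℕP.+-suc m n) ⟨
    - ⟦ suc m ℕ.+ suc n ⟧ℕ            ≈⟨ -‿cong (×-homo-+ 1# (suc m) (suc n)) ⟩
    - (⟦ suc m ⟧ℕ + ⟦ suc n ⟧ℕ)       ≈⟨ -‿+-comm _ _ ⟨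
    - ⟦ suc m ⟧ℕ + - ⟦ suc n ⟧ℕ       ∎

  *-homo : ∀ i j → ⟦ i ℤ.* j ⟧ℤ ≈ ⟦ i ⟧ℤ * ⟦ j ⟧ℤ
  *-homo (+ m)    (+ n)    = trans (◃-homo Sign.+ (m ℕ.* n)) (×1-homo-* m n)
  *-homo (+ m)    -[1+ n ] = trans (◃-homo Sign.- (m ℕ.* suc n))
                               (trans (-‿cong (×1-homo-* m (suc n))) (-‿distribʳ-* _ _))
  *-homo -[1+ m ] (+ n)    = trans (◃-homo Sign.- (suc m ℕ.* n))
                               (trans (-‿cong (×1-homo-* (suc m) n)) (-‿distribˡ-* _ _))
  *-homo -[1+ m ] -[1+ n ] = trans (◃-homo Sign.+ (suc m ℕ.* suc n)) (trans (×1-homo-* (suc m) (suc n))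
                               (trans (sym (-‿involutive _)) (trans (-‿cong (-‿distribˡ-* _ _)) (-‿distribʳ-* _ _))))

  neg-homo : ∀ i → ⟦ ℤ.- i ⟧ℤ ≈ - ⟦ i ⟧ℤ
  neg-homo (+ zero)  = sym -0#≈0#
  neg-homo (+ suc n) = refl
  neg-homo -[1+ n ]  = sym (-‿involutive _)

  ℤ-rawRing : RawRing _ _
  ℤ-rawRing = CommutativeRing.rawRing ℤP.+-*-commutativeRing

  ℤ⟶R : ℤ-rawRing -Raw-AlmostCommutative⟶ fromCommutativeRing R
  ℤ⟶R = record { ⟦_⟧ = ⟦_⟧ℤ ; +-homo = +-homo ; *-homo = *-homo ; -‿homo = neg-homo
               ; 0-homo = refl ; 1-homo = refl }

  coeff≟ : ∀ i j → Maybe (⟦ i ⟧ℤ ≈ ⟦ j ⟧ℤ)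
  coeff≟ i j with i ℤ.≟ j
  ... | yes ≡.refl = just refl
  ... | no _       = nothing

  open import Algebra.Solver.Ring ℤ-rawRing (fromCommutativeRing R) ℤ⟶R coeff≟ public

module FiniteSums {c ℓ} (R : CommutativeRing c ℓ) where
  open CommutativeRing R hiding (zero)
  open RingDefs R
  open IntegerSolver R using (solve; _:+_; _:*_; _:=_; con)
  open import Algebra.Properties.Ring ring using (-‿+-comm; -0#≈0#)
  open import Relation.Binary.Reasoning.Setoid setoid

  ≡⇒≈ : ∀ {a b} → a ≡ b → a ≈ b
  ≡⇒≈ ≡.refl = refl

  Σ-cong : ∀ {k} {f g : Fin k → Carrier} → (∀ i → f i ≈ g i) → sumFin f ≈ sumFin g
  Σ-cong {zero}  f≈g = refl
  Σ-cong {suc k} f≈g = +-cong (f≈g zero) (Σ-cong (f≈g ∘ suc))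

  Σ-0 : ∀ {k} {f : Fin k → Carrier} → (∀ i → f i ≈ 0#) → sumFin f ≈ 0#
  Σ-0 {zero}  f≈0 = refl
  Σ-0 {suc k} f≈0 = trans (+-cong (f≈0 zero) (Σ-0 (f≈0 ∘ suc))) (+-identityʳ 0#)

  Σ-+ : ∀ {k} (f g : Fin k → Carrier) → sumFin (λ i → f i + g i) ≈ sumFin f + sumFin g
  Σ-+ {zero}  f g = sym (+-identityʳ 0#)
  Σ-+ {suc k} f g = trans (+-congˡ (Σ-+ (f ∘ suc) (g ∘ suc)))
                          (solve 4 (λ a b c d → (a :+ b) :+ (c :+ d) := (a :+ c) :+ (b :+ d)) refl _ _ _ _)

  Σ-*ˡ : ∀ {k} (a : Carrier) (f : Fin k → Carrier) → a * sumFin f ≈ sumFin (λ i → a * f i)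
  Σ-*ˡ {zero}  a f = zeroʳ a
  Σ-*ˡ {suc k} a f = trans (distribˡ a (f zero) _) (+-congˡ (Σ-*ˡ a (f ∘ suc)))

  Σ-neg : ∀ {k} (f : Fin k → Carrier) → sumFin (λ i → - f i) ≈ - sumFin f
  Σ-neg {zero}  f = sym -0#≈0#
  Σ-neg {suc k} f = trans (+-congˡ (Σ-neg (f ∘ suc))) (-‿+-comm _ _)

  Σ-*ʳ : ∀ {k} (a : Carrier) (f : Fin k → Carrier) → sumFin f * a ≈ sumFin (λ i → f i * a)
  Σ-*ʳ a f = trans (*-comm _ a) (trans (Σ-*ˡ a f) (Σ-cong (λ i → *-comm a (f i))))

  Σ-linear : ∀ {k} (a : Carrier) {f g h : Fin k → Carrier} → (∀ i → f i ≈ a * g i + h i) →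
    sumFin f ≈ a * sumFin g + sumFin h
  Σ-linear a {f} {g} {h} eq = begin
    sumFin f                                    ≈⟨ Σ-cong eq ⟩
    sumFin (λ i → a * g i + h i)                ≈⟨ Σ-+ (λ i → a * g i) h ⟩
    sumFin (λ i → a * g i) + sumFin h           ≈⟨ +-congʳ (Σ-*ˡ a g) ⟨
    a * sumFin g + sumFin h                     ∎

  Σ-const : ∀ {k} (a : Carrier) → sumFin {k} (λ _ → a) ≈ fromℕ k * a
  Σ-const {zero}  a = sym (zeroˡ a)
  Σ-const {suc k} a = trans (+-congˡ (Σ-const {k} a))
                            (solve 2 (λ a n → a :+ n :* a := (con (+ 1) :+ n) :* a) refl a (fromℕ k))

  Σ-swap : ∀ {k l} (f : Fin k → Fin l → Carrier) →
    sumFin (λ i → sumFin (f i)) ≈ sumFin (λ j → sumFin (λ i → f i j))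
  Σ-swap {zero}  {l} f = sym (Σ-0 {l} (λ _ → refl))
  Σ-swap {suc k}     f = trans (+-congˡ (Σ-swap (f ∘ suc))) (sym (Σ-+ (f zero) (λ j → sumFin (λ i → f (suc i) j))))

  Σ-punch : ∀ {k} (j : Fin (suc k)) (f : Fin (suc k) → Carrier) →
    sumFin f ≈ f j + sumFin (f ∘ punchIn j)
  Σ-punch          zero    f = refl
  Σ-punch {suc k} (suc j) f = trans (+-congˡ (Σ-punch j (f ∘ suc)))
    (solve 3 (λ a b c → a :+ (b :+ c) := b :+ (a :+ c)) refl (f zero) (f (suc j)) _)

  Σ-delta : ∀ {k} (i : Fin k) (f : Fin k → Bool → Carrier) → (∀ j → f j false ≈ 0#) →
    sumFin (λ j → f j (j == i)) ≈ f i true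
  Σ-delta {suc k} i f off = begin
      sumFin (λ j → f j (j == i))
    ≈⟨ Σ-punch i (λ j → f j (j == i)) ⟩
      f i (i == i) + sumFin (λ l → f (punchIn i l) (punchIn i l == i))
    ≈⟨ +-cong (≡⇒≈ (≡.cong (f i) (==-refl i)))
              (Σ-0 (λ l → trans (≡⇒≈ (≡.cong (f (punchIn i l)) (==-false (FinP.punchInᵢ≢i i l)))) (off _))) ⟩
      f i true + 0#
    ≈⟨ +-identityʳ _ ⟩
      f i true ∎

  Σ-split : ∀ a b (f : Fin (a ℕ.+ b) → Carrier) →
    sumFin f ≈ sumFin (λ u → f (u ↑ˡ b)) + sumFin (λ e → f (a ↑ʳ e))
  Σ-split zero    b f = sym (+-identityˡ _)
  Σ-split (suc a) b f = trans (+-congˡ (Σ-split a b (f ∘ suc))) (sym (+-assoc _ _ _))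

  Σ-antisymmetric : ∀ {k} (G : Fin k → Fin k → Carrier) → (∀ j → G j j ≈ 0#) →
    (∀ j j' → j ≢ j' → G j j' + G j' j ≈ 0#) → sumFin (λ j → sumFin (G j)) ≈ 0#
  Σ-antisymmetric {zero}  G diag anti = refl
  Σ-antisymmetric {suc k} G diag anti = begin
      (G zero zero + sumFin (G zero ∘ suc)) + sumFin (λ i → G (suc i) zero + sumFin (G (suc i) ∘ suc))
    ≈⟨ +-congˡ (Σ-+ (λ i → G (suc i) zero) (λ i → sumFin (G (suc i) ∘ suc))) ⟩
      (G zero zero + sumFin (G zero ∘ suc)) + (sumFin (λ i → G (suc i) zero) + sumFin (λ i → sumFin (G (suc i) ∘ suc)))
    ≈⟨ solve 4 (λ g x y w → (g :+ x) :+ (y :+ w) := g :+ (x :+ y) :+ w) refl (G zero zero) _ _ _ ⟩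
      G zero zero + (sumFin (G zero ∘ suc) + sumFin (λ i → G (suc i) zero)) + sumFin (λ i → sumFin (G (suc i) ∘ suc))
    ≈⟨ +-cong (+-cong (diag zero) (trans (sym (Σ-+ (G zero ∘ suc) (λ i → G (suc i) zero)))
                                          (Σ-0 (λ i → anti zero (suc i) (λ ())))))
              (Σ-antisymmetric (λ i i' → G (suc i) (suc i')) (diag ∘ suc) (λ i i' i≢i' → anti _ _ (i≢i' ∘ FinP.suc-injective))) ⟩
      0# + 0# + 0#
    ≈⟨ trans (+-identityʳ _) (+-identityʳ _) ⟩
      0# ∎

  prodFin : ∀ {k} → (Fin k → Carrier) → Carrier
  prodFin {zero}  f = 1#
  prodFin {suc k} f = f zero * prodFin (f ∘ suc)

  Π-const : ∀ {k} {f : Fin k → Carrier} (a : Carrier) → (∀ i → f i ≈ a) → prodFin f ≈ pow a k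
  Π-const {zero}  a f≈a = refl
  Π-const {suc k} a f≈a = *-cong (f≈a zero) (Π-const a (f≈a ∘ suc))

  Π-1 : ∀ {k} {f : Fin k → Carrier} → (∀ i → f i ≈ 1#) → prodFin f ≈ 1#
  Π-1 {zero}  f≈1 = refl
  Π-1 {suc k} f≈1 = trans (*-cong (f≈1 zero) (Π-1 (f≈1 ∘ suc))) (*-identityˡ 1#)

  Π-split : ∀ a b (f : Fin (a ℕ.+ b) → Carrier) →
    prodFin f ≈ prodFin (λ u → f (u ↑ˡ b)) * prodFin (λ e → f (a ↑ʳ e))
  Π-split zero    b f = sym (*-identityˡ _)
  Π-split (suc a) b f = trans (*-congˡ (Π-split a b (f ∘ suc))) (sym (*-assoc _ _ _))

module Determinants {c ℓ} (R : CommutativeRing c ℓ) where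
  open CommutativeRing R hiding (zero)
  open RingDefs R
  open IntegerSolver R using (solve; _:+_; _:*_; :-_; _:=_; con)
  open FiniteSums R
  open import Algebra.Properties.Ring ring using (-‿involutive; -‿distribˡ-*; -0#≈0#; +-inverseʳ-unique)
  open import Relation.Binary.Reasoning.Setoid setoid


  Mat : ℕ → Set c
  Mat k = Fin k → Fin k → Carrier

  minor : ∀ {k} → Mat (suc k) → Fin (suc k) → Mat k
  minor M j a b = M (suc a) (punchIn j b)

  cofactorTerm : ∀ {k} → Mat (suc k) → Fin (suc k) → Carrier
  cofactorTerm M j = sign (toℕ j) * (M zero j * det (minor M j))

  det-cong : ∀ {k} {M N : Mat k} → (∀ a b → M a b ≈ N a b) → det M ≈ det N
  det-cong {zero}  M≈N = refl
  det-cong {suc k} {M} {N} M≈N =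
    Σ-cong {f = cofactorTerm M} {g = cofactorTerm N} (λ j → *-congˡ (*-cong (M≈N zero j) (det-cong (λ a b → M≈N (suc a) (punchIn j b)))))

  det-linearRow : ∀ {k} (i : Fin k) (a : Carrier) (M N Q : Mat k) →
    (∀ r → r ≢ i → ∀ b → M r b ≈ N r b) → (∀ r → r ≢ i → ∀ b → M r b ≈ Q r b) →
    (∀ b → M i b ≈ a * N i b + Q i b) → det M ≈ a * det N + det Q
  det-linearRow {suc k} zero a M N Q M≈N M≈Q row = Σ-linear a termwise
    where
    termwise : ∀ j → cofactorTerm M j ≈ a * cofactorTerm N j + cofactorTerm Q j
    termwise j = begin
        sign (toℕ j) * (M zero j * det (minor M j))
      ≈⟨ *-congˡ (*-congʳ (row j)) ⟩
        sign (toℕ j) * ((a * N zero j + Q zero j) * det (minor M j))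
      ≈⟨ solve 5 (λ s n q a d → s :* ((a :* n :+ q) :* d) := a :* (s :* (n :* d)) :+ s :* (q :* d))
                 refl (sign (toℕ j)) (N zero j) (Q zero j) a (det (minor M j)) ⟩
        a * (sign (toℕ j) * (N zero j * det (minor M j))) + sign (toℕ j) * (Q zero j * det (minor M j))
      ≈⟨ +-cong (*-congˡ (*-congˡ (*-congˡ (det-cong (λ x _ → M≈N (suc x) (λ ()) _)))))
                (*-congˡ (*-congˡ (det-cong (λ x _ → M≈Q (suc x) (λ ()) _)))) ⟩
        a * cofactorTerm N j + cofactorTerm Q j ∎
  det-linearRow {suc k} (suc i) a M N Q M≈N M≈Q row = Σ-linear a termwise
    where
    termwise : ∀ j → cofactorTerm M j ≈ a * cofactorTerm N j + cofactorTerm Q j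
    termwise j = begin
        sign (toℕ j) * (M zero j * det (minor M j))
      ≈⟨ *-congˡ (*-congˡ (det-linearRow i a (minor M j) (minor N j) (minor Q j)
           (λ r r≢i _ → M≈N (suc r) (r≢i ∘ FinP.suc-injective) _)
           (λ r r≢i _ → M≈Q (suc r) (r≢i ∘ FinP.suc-injective) _)
           (λ b → row (punchIn j b)))) ⟩
        sign (toℕ j) * (M zero j * (a * det (minor N j) + det (minor Q j)))
      ≈⟨ solve 5 (λ s m a d e → s :* (m :* (a :* d :+ e)) := a :* (s :* (m :* d)) :+ s :* (m :* e))
                 refl (sign (toℕ j)) (M zero j) a (det (minor N j)) (det (minor Q j)) ⟩
        a * (sign (toℕ j) * (M zero j * det (minor N j))) + sign (toℕ j) * (M zero j * det (minor Q j))
      ≈⟨ +-cong (*-congˡ (*-congˡ (*-congʳ (M≈N zero (λ ()) j)))) (*-congˡ (*-congʳ (M≈Q zero (λ ()) j))) ⟩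
        a * cofactorTerm N j + cofactorTerm Q j ∎

  det-additiveRow : ∀ {k} (i : Fin k) (M N Q : Mat k) →
    (∀ r → r ≢ i → ∀ b → M r b ≈ N r b) → (∀ r → r ≢ i → ∀ b → M r b ≈ Q r b) →
    (∀ b → M i b ≈ N i b + Q i b) → det M ≈ det N + det Q
  det-additiveRow i M N Q M≈N M≈Q row =
    trans (det-linearRow i 1# M N Q M≈N M≈Q (λ b → trans (row b) (+-congʳ (sym (*-identityˡ _)))))
          (+-congʳ (*-identityˡ _))

  det-zeroRow : ∀ {k} (i : Fin k) (M : Mat k) → (∀ b → M i b ≈ 0#) → det M ≈ 0#
  det-zeroRow i M row≈0 =
    trans (det-linearRow i (- 1#) M M M (λ _ _ _ → refl) (λ _ _ _ → refl)
            (λ b → trans (row≈0 b) (sym (cancel (M i b)))))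
          (cancel (det M))
    where
    cancel : ∀ x → - 1# * x + x ≈ 0#
    cancel = solve 1 (λ x → :- con (+ 1) :* x :+ x := con (+ 0)) refl

  setRow : ∀ {k} → Mat k → Fin k → (Fin k → Carrier) → Mat k
  setRow M i v r = if r == i then v else M r

  setRow-same : ∀ {k} (M : Mat k) i v b → setRow M i v i b ≈ v b
  setRow-same M i v b rewrite ==-refl i = refl

  setRow-other : ∀ {k} (M : Mat k) {i r} v b → r ≢ i → setRow M i v r b ≈ M r b
  setRow-other M v b r≢i rewrite ==-false r≢i = refl

  setRow-cong : ∀ {k} {M N : Mat k} (i : Fin k) (v : Fin k → Carrier) → (∀ r b → M r b ≈ N r b) →
    ∀ r b → setRow M i v r b ≈ setRow N i v r b
  setRow-cong i v M≈N r b with r == i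
  ... | true  = refl
  ... | false = M≈N r b

  sign-+ : ∀ a b → sign (a ℕ.+ b) ≈ sign a * sign b
  sign-+ zero    b = sym (*-identityˡ _)
  sign-+ (suc a) b = trans (-‿cong (sign-+ a b)) (-‿distribˡ-* _ _)

  sign-cancel : ∀ {a b} → suc a ≡ b → sign a + sign b ≈ 0#
  sign-cancel {a} ≡.refl = -‿inverseʳ (sign a)

  sign-punchOut : ∀ {k} (j j' : Fin (suc (suc k))) (j≢j' : j ≢ j') (j'≢j : j' ≢ j) →
    sign (toℕ j) * sign (toℕ (punchOut j≢j')) + sign (toℕ j') * sign (toℕ (punchOut j'≢j)) ≈ 0#
  sign-punchOut j j' j≢j' j'≢j with punchOut-parity j j' j≢j' j'≢j
  ... | inj₁ eq = trans (sym (+-cong (sign-+ (toℕ j) _) (sign-+ (toℕ j') _))) (sign-cancel eq)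
  ... | inj₂ eq = trans (+-comm _ _) (trans (sym (+-cong (sign-+ (toℕ j') _) (sign-+ (toℕ j) _))) (sign-cancel eq))

  -- Expanding along rows 0 and 1, the term for the columns (j, j') and
  -- the term for (j', j) cancel when the two rows are equal.
  det-rows01 : ∀ {k} (M : Mat (suc (suc k))) → (∀ b → M zero b ≈ M (suc zero) b) → det M ≈ 0#
  det-rows01 {k} M row0≈row1 = begin
      det M                          ≈⟨ Σ-cong expand ⟩
      sumFin (λ j → sumFin (F j))    ≈⟨ Σ-cong reindex ⟩
      sumFin (λ j → sumFin (G j))    ≈⟨ Σ-antisymmetric G G-diag G-anti ⟩
      0#                             ∎
    where
    D : Fin (suc (suc k)) → Fin (suc k) → Carrier
    D j l = det (λ a b → M (suc (suc a)) (punchIn j (punchIn l b)))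
    F : Fin (suc (suc k)) → Fin (suc k) → Carrier
    F j l = sign (toℕ j) * (M zero j * (sign (toℕ l) * (M (suc zero) (punchIn j l) * D j l)))
    expand : ∀ j → cofactorTerm M j ≈ sumFin (F j)
    expand j = trans (*-congˡ (Σ-*ˡ (M zero j) inner)) (Σ-*ˡ (sign (toℕ j)) (λ l → M zero j * inner l))
      where
      inner : Fin (suc k) → Carrier
      inner l = sign (toℕ l) * (M (suc zero) (punchIn j l) * D j l)
    -- F j indexed by the second deleted column j' itself
    pick : ∀ j j' → Dec (j ≡ j') → Carrier
    pick j j' (yes _)    = 0#
    pick j j' (no j≢j')  = F j (punchOut j≢j')
    G : Fin (suc (suc k)) → Fin (suc (suc k)) → Carrier
    G j j' = pick j j' (j FinP.≟ j')
    G-diag : ∀ j → G j j ≈ 0#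
    G-diag j with j FinP.≟ j
    ... | yes _  = refl
    ... | no j≢j = ⊥-elim (j≢j ≡.refl)
    reindex : ∀ j → sumFin (F j) ≈ sumFin (G j)
    reindex j = sym (trans (Σ-punch j (G j)) (trans (+-cong (G-diag j) (Σ-cong G-punchIn)) (+-identityˡ _)))
      where
      G-punchIn : ∀ l → G j (punchIn j l) ≈ F j l
      G-punchIn l with j FinP.≟ punchIn j l
      ... | yes j≡ = ⊥-elim (FinP.punchInᵢ≢i j l (≡.sym j≡))
      ... | no _   = ≡⇒≈ (≡.cong (F j) (≡.trans (FinP.punchOut-cong j ≡.refl) (FinP.punchOut-punchIn j)))
    cancel : ∀ j j' (j≢j' : j ≢ j') (j'≢j : j' ≢ j) → F j (punchOut j≢j') + F j' (punchOut j'≢j) ≈ 0#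
    cancel j j' j≢j' j'≢j = begin
        F j p + F j' p'
      ≈⟨ +-cong (*-congˡ (*-congˡ (*-congˡ (*-congʳ Mpj))))
                (*-congˡ (*-congˡ (*-congˡ (*-cong Mpj' (det-cong (λ a b → ≡⇒≈ (≡.cong (M (suc (suc a)))
                   (≡.sym (punchIn-commute j j' j≢j' j'≢j b))))))))) ⟩
        sj * (A * (sp * (B * d))) + sj' * (B * (sp' * (A * d)))
      ≈⟨ solve 7 (λ sj sp sj' sp' A B d → sj :* (A :* (sp :* (B :* d))) :+ sj' :* (B :* (sp' :* (A :* d)))
                   := (sj :* sp :+ sj' :* sp') :* (A :* (B :* d))) refl sj sp sj' sp' A B d ⟩
        (sj * sp + sj' * sp') * (A * (B * d))
      ≈⟨ *-congʳ (sign-punchOut j j' j≢j' j'≢j) ⟩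
        0# * (A * (B * d))
      ≈⟨ zeroˡ _ ⟩
        0# ∎
      where
      p p' : Fin (suc k)
      p = punchOut j≢j'
      p' = punchOut j'≢j
      sj sp sj' sp' A B d : Carrier
      sj = sign (toℕ j)
      sp = sign (toℕ p)
      sj' = sign (toℕ j')
      sp' = sign (toℕ p')
      A = M zero j
      B = M zero j'
      d = D j p
      Mpj : M (suc zero) (punchIn j p) ≈ B
      Mpj = trans (≡⇒≈ (≡.cong (M (suc zero)) (FinP.punchIn-punchOut j≢j'))) (sym (row0≈row1 j'))
      Mpj' : M (suc zero) (punchIn j' p') ≈ A
      Mpj' = trans (≡⇒≈ (≡.cong (M (suc zero)) (FinP.punchIn-punchOut j'≢j))) (sym (row0≈row1 j))
    G-anti : ∀ j j' → j ≢ j' → G j j' + G j' j ≈ 0#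
    G-anti j j' j≢j' with j FinP.≟ j' | j' FinP.≟ j
    ... | yes j≡j' | _         = ⊥-elim (j≢j' j≡j')
    ... | no _     | yes j'≡j  = ⊥-elim (j≢j' (≡.sym j'≡j))
    ... | no j≢j'₁ | no j'≢j   = cancel j j' j≢j'₁ j'≢j

  Alternating : ℕ → Set (c ⊔ ℓ)
  Alternating k = ∀ (M : Mat k) p q → p ≢ q → (∀ b → M p b ≈ M q b) → det M ≈ 0#

  -- If det is alternating in dimension k, exchanging two rows p ≠ q
  -- negates it: expand det W(s, s) = 0 for s = row p + row q by
  -- additivity in rows p and q, where W(u, v) is M with rows p, q set to u, v.
  det-swap : ∀ {k} → Alternating k → (M : Mat k) (p q : Fin k) → p ≢ q →
    det (λ r → M (transpose p q r)) ≈ - det M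
  det-swap {k} alt M p q p≢q = +-inverseʳ-unique (det M) (det Mτ) sum≈0
    where
    Mτ : Mat k
    Mτ r = M (transpose p q r)
    W : (Fin k → Carrier) → (Fin k → Carrier) → Mat k
    W u v = setRow (setRow M q v) p u
    W-p : ∀ u v b → W u v p b ≈ u b
    W-p u v b = setRow-same (setRow M q v) p u b
    W-q : ∀ u v b → W u v q b ≈ v b
    W-q u v b = trans (setRow-other (setRow M q v) u b (p≢q ∘ ≡.sym)) (setRow-same M q v b)
    W-offp : ∀ u u' v r → r ≢ p → ∀ b → W u v r b ≈ W u' v r b
    W-offp u u' v r r≢p b = trans (setRow-other (setRow M q v) u b r≢p) (sym (setRow-other (setRow M q v) u' b r≢p))
    W-offq : ∀ u v v' r → r ≢ q → ∀ b → W u v r b ≈ W u v' r b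
    W-offq u v v' r r≢q b with r FinP.≟ p
    ... | yes ≡.refl = refl
    ... | no _       = trans (setRow-other M v b r≢q) (sym (setRow-other M v' b r≢q))
    W-det : ∀ (X : Mat k) u v → (∀ b → X p b ≈ u b) → (∀ b → X q b ≈ v b) →
      (∀ r → r ≢ p → r ≢ q → ∀ b → X r b ≈ M r b) → det X ≈ det (W u v)
    W-det X u v Xp Xq Xr = det-cong pointwise
      where
      pointwise : ∀ r b → X r b ≈ W u v r b
      pointwise r b with r FinP.≟ p | r FinP.≟ q
      ... | yes ≡.refl | _          = Xp b
      ... | no _       | yes ≡.refl = Xq b
      ... | no r≢p     | no r≢q     = Xr r r≢p r≢q b
    s : Fin k → Carrier
    s b = M p b + M q b
    W-diag : ∀ u → det (W u u) ≈ 0#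
    W-diag u = alt (W u u) p q p≢q (λ b → trans (W-p u u b) (sym (W-q u u b)))
    split-p : ∀ v → det (W s v) ≈ det (W (M p) v) + det (W (M q) v)
    split-p v = det-additiveRow p (W s v) (W (M p) v) (W (M q) v) (W-offp s (M p) v) (W-offp s (M q) v)
                  (λ b → trans (W-p s v b) (sym (+-cong (W-p (M p) v b) (W-p (M q) v b))))
    split-q : ∀ u → det (W u s) ≈ det (W u (M p)) + det (W u (M q))
    split-q u = det-additiveRow q (W u s) (W u (M p)) (W u (M q)) (W-offq u s (M p)) (W-offq u s (M q))
                  (λ b → trans (W-q u s b) (sym (+-cong (W-q u (M p) b) (W-q u (M q) b))))
    Mτ-rows : ∀ r {r'} → transpose p q r ≡ r' → ∀ b → Mτ r b ≈ M r' b
    Mτ-rows _ eq b = ≡⇒≈ (≡.cong (λ r → M r b) eq)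
    sum≈0 : det M + det Mτ ≈ 0#
    sum≈0 = begin
        det M + det Mτ
      ≈⟨ +-cong (W-det M (M p) (M q) (λ _ → refl) (λ _ → refl) (λ _ _ _ _ → refl))
                (W-det Mτ (M q) (M p) (Mτ-rows p (transpose-at-i p q)) (Mτ-rows q (transpose-at-j p q))
                       (λ r r≢p r≢q → Mτ-rows r (transpose-other p q r≢p r≢q))) ⟩
        det (W (M p) (M q)) + det (W (M q) (M p))
      ≈⟨ +-cong (trans (sym (+-identityˡ _)) (+-congʳ (sym (W-diag (M p)))))
                (trans (sym (+-identityʳ _)) (+-congˡ (sym (W-diag (M q))))) ⟩
        (det (W (M p) (M p)) + det (W (M p) (M q))) + (det (W (M q) (M p)) + det (W (M q) (M q)))
      ≈⟨ +-cong (split-q (M p)) (split-q (M q)) ⟨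
        det (W (M p) s) + det (W (M q) s)
      ≈⟨ split-p s ⟨
        det (W s s)
      ≈⟨ W-diag s ⟩
        0# ∎

  -- Exchanging two rows other than row 0 exchanges the corresponding rows
  -- of every minor.
  det-swapBelow : ∀ {k} → Alternating k → (M : Mat (suc k)) (p q : Fin k) → p ≢ q →
    det (λ r → M (transpose (suc p) (suc q) r)) ≈ - det M
  det-swapBelow alt M p q p≢q = trans (Σ-cong termwise) (Σ-neg (cofactorTerm M))
    where
    Mτ : Mat _
    Mτ r = M (transpose (suc p) (suc q) r)
    termwise : ∀ j → cofactorTerm Mτ j ≈ - cofactorTerm M j
    termwise j = begin
        sign (toℕ j) * (Mτ zero j * det (minor Mτ j))
      ≈⟨ *-congˡ (*-cong (≡⇒≈ (≡.cong (λ r → M r j) (transpose-other (suc p) (suc q) (λ ()) (λ ()))))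
                         (det-cong (λ a b → ≡⇒≈ (≡.cong (λ r → M r (punchIn j b)) (transpose-suc p q a))))) ⟩
        sign (toℕ j) * (M zero j * det (λ a → minor M j (transpose p q a)))
      ≈⟨ *-congˡ (*-congˡ (det-swap alt (minor M j) p q p≢q)) ⟩
        sign (toℕ j) * (M zero j * - det (minor M j))
      ≈⟨ solve 3 (λ s m d → s :* (m :* (:- d)) := :- (s :* (m :* d))) refl _ _ _ ⟩
        - cofactorTerm M j ∎

  -- Rows 0 and suc q equal: for q ≠ 0 exchange rows 1 and suc q first.
  det-row0-equal : ∀ {k} → Alternating k → (M : Mat (suc k)) (q : Fin k) →
    (∀ b → M zero b ≈ M (suc q) b) → det M ≈ 0#
  det-row0-equal alt M zero    eq = det-rows01 M eq
  det-row0-equal alt M (suc q) eq = begin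
      det M           ≈⟨ -‿involutive (det M) ⟨
      - (- det M)     ≈⟨ -‿cong (det-swapBelow alt M zero (suc q) (λ ())) ⟨
      - det M'        ≈⟨ -‿cong (det-rows01 M' rows01) ⟩
      - 0#            ≈⟨ -0#≈0# ⟩
      0#              ∎
    where
    M' : Mat _
    M' r = M (transpose (suc zero) (suc (suc q)) r)
    rows01 : ∀ b → M' zero b ≈ M' (suc zero) b
    rows01 b = trans (≡⇒≈ (≡.cong (λ r → M r b) (transpose-other (suc zero) (suc (suc q)) (λ ()) (λ ()))))
                 (trans (eq b) (≡⇒≈ (≡.cong (λ r → M r b) (≡.sym (transpose-at-i (suc zero) (suc (suc q)))))))

  det-alternating : ∀ {k} → Alternating k
  det-alternating {suc k} M zero    zero    0≢0 _  = ⊥-elim (0≢0 ≡.refl)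
  det-alternating {suc k} M zero    (suc q) _   eq = det-row0-equal det-alternating M q eq
  det-alternating {suc k} M (suc p) zero    _   eq = det-row0-equal det-alternating M p (sym ∘ eq)
  det-alternating {suc k} M (suc p) (suc q) p≢q eq = Σ-0 {f = cofactorTerm M} (λ j → trans (*-congˡ (trans
    (*-congˡ (det-alternating (minor M j) p q (p≢q ∘ ≡.cong suc) (eq ∘ punchIn j))) (zeroʳ _))) (zeroʳ _))

  det-rowCombination : ∀ {k t} (i : Fin k) (M : Mat k) (cf : Fin t → Carrier) (V : Fin t → Fin k → Carrier) →
    det (setRow M i (λ b → sumFin (λ j → cf j * V j b))) ≈ sumFin (λ j → cf j * det (setRow M i (V j)))
  det-rowCombination {t = zero}  i M cf V = det-zeroRow i _ (setRow-same M i _)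
  det-rowCombination {t = suc t} i M cf V =
    trans (det-linearRow i (cf zero) _ (setRow M i (V zero)) (setRow M i rest) same same row)
          (+-congˡ (det-rowCombination i M (cf ∘ suc) (V ∘ suc)))
    where
    rest : Fin _ → Carrier
    rest b = sumFin (λ j → cf (suc j) * V (suc j) b)
    same : ∀ {u v} r → r ≢ i → ∀ b → setRow M i u r b ≈ setRow M i v r b
    same {u} {v} r r≢i b = trans (setRow-other M u b r≢i) (sym (setRow-other M v b r≢i))
    row : ∀ b → setRow M i _ i b ≈ cf zero * setRow M i (V zero) i b + setRow M i rest i b
    row b = trans (setRow-same M i _ b) (sym (+-cong (*-congˡ (setRow-same M i (V zero) b)) (setRow-same M i rest b)))

  det-addRow : ∀ {k} (i : Fin k) (cf : Fin k → Carrier) (M M' : Mat k) → cf i ≈ 0# →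
    (∀ r → r ≢ i → ∀ b → M' r b ≈ M r b) → (∀ b → M' i b ≈ M i b + sumFin (λ j → cf j * M j b)) →
    det M' ≈ det M
  det-addRow i cf M M' cfᵢ≈0 off row = begin
      det M'
    ≈⟨ det-additiveRow i M' M Q off (λ r r≢i b → trans (off r r≢i b) (sym (setRow-other M _ b r≢i)))
                                    (λ b → trans (row b) (+-congˡ (sym (setRow-same M i _ b)))) ⟩
      det M + det Q
    ≈⟨ +-congˡ (trans (det-rowCombination i M cf M) (Σ-0 vanish)) ⟩
      det M + 0#
    ≈⟨ +-identityʳ _ ⟩
      det M ∎
    where
    Q : Mat _
    Q = setRow M i (λ b → sumFin (λ j → cf j * M j b))
    vanish : ∀ j → cf j * det (setRow M i (M j)) ≈ 0#
    vanish j with j FinP.≟ i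
    ... | yes ≡.refl = trans (*-congʳ cfᵢ≈0) (zeroˡ _)
    ... | no j≢i     = trans (*-congˡ (det-alternating (setRow M i (M j)) i j (j≢i ∘ ≡.sym)
                         (λ b → trans (setRow-same M i (M j) b) (sym (setRow-other M (M j) b j≢i))))) (zeroʳ _)

  -- The rows are processed one at a time: Mₜ has the rows r < t updated.
  det-addRows : ∀ {k} (src : Fin k → Bool) (cf : Fin k → Fin k → Carrier) (M : Mat k) →
    (∀ r j → src j ≡ false → cf r j ≈ 0#) → (∀ r j → src r ≡ true → cf r j ≈ 0#) →
    det (λ r b → M r b + sumFin (λ j → cf r j * M j b)) ≈ det M
  det-addRows {k} src cf M unused fixed = trans (det-cong allProcessed) (processed k ℕP.≤-refl)
    where
    M' : Mat k
    M' r b = M r b + sumFin (λ j → cf r j * M j b)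
    Mt : ℕ → Mat k
    Mt t r b = if toℕ r ℕ.<ᵇ t then M' r b else M r b
    allProcessed : ∀ r b → M' r b ≈ Mt k r b
    allProcessed r b rewrite <ᵇ-true (FinP.toℕ<n r) = refl
    cf-diag : ∀ r → cf r r ≈ 0#
    cf-diag r with src r in eq
    ... | true  = fixed r r eq
    ... | false = unused r r eq
    source : ∀ t j → src j ≡ true → ∀ b → Mt t j b ≈ M j b
    source t j srcⱼ b with toℕ j ℕ.<ᵇ t
    ... | true  = trans (+-congˡ (Σ-0 (λ l → trans (*-congʳ (fixed j l srcⱼ)) (zeroˡ _)))) (+-identityʳ _)
    ... | false = refl
    use : ∀ t r b j → cf r j * M j b ≈ cf r j * Mt t j b
    use t r b j with src j in eq
    ... | true  = *-congˡ (sym (source t j eq b))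
    ... | false = trans (*-congʳ (unused r j eq)) (trans (zeroˡ _) (sym (trans (*-congʳ (unused r j eq)) (zeroˡ _))))
    processed : ∀ t → t ℕ.≤ k → det (Mt t) ≈ det M
    processed zero    _   = refl
    processed (suc t) t<k = trans (det-addRow i (cf i) (Mt t) (Mt (suc t)) (cf-diag i) off row) (processed t (ℕP.<⇒≤ t<k))
      where
      i : Fin k
      i = fromℕ< t<k
      toℕi≡t : toℕ i ≡ t
      toℕi≡t = FinP.toℕ-fromℕ< t<k
      off : ∀ r → r ≢ i → ∀ b → Mt (suc t) r b ≈ Mt t r b
      off r r≢i b = ≡⇒≈ (≡.cong (λ β → if β then M' r b else M r b)
                      (<ᵇ-suc (λ eq → r≢i (FinP.toℕ-injective (≡.trans eq (≡.sym toℕi≡t))))))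
      row : ∀ b → Mt (suc t) i b ≈ Mt t i b + sumFin (λ j → cf i j * Mt t j b)
      row b rewrite toℕi≡t | <ᵇ-true (ℕP.n<1+n t) | <ᵇ-irrefl t = +-congˡ (Σ-cong (use t i b))

  det-scaleRows : ∀ {k} (s : Fin k → Carrier) (M : Mat k) →
    det (λ r b → s r * M r b) ≈ prodFin s * det M
  det-scaleRows {zero}  s M = sym (*-identityˡ 1#)
  det-scaleRows {suc k} s M = trans (Σ-cong termwise) (sym (Σ-*ˡ (prodFin s) (cofactorTerm M)))
    where
    termwise : ∀ j → cofactorTerm (λ r b → s r * M r b) j ≈ prodFin s * cofactorTerm M j
    termwise j = trans (*-congˡ (*-congˡ (det-scaleRows (s ∘ suc) (minor M j))))
      (solve 5 (λ σ s₀ m P d → σ :* ((s₀ :* m) :* (P :* d)) := (s₀ :* P) :* (σ :* (m :* d)))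
             refl (sign (toℕ j)) (s zero) (M zero j) (prodFin (s ∘ suc)) (det (minor M j)))

  det-diagonal : ∀ {k} (d : Fin k → Carrier) (M : Mat k) → (∀ a → M a a ≈ d a) →
    (∀ a b → a ≢ b → M a b ≈ 0#) → det M ≈ prodFin d
  det-diagonal {zero}  d M diag off = refl
  det-diagonal {suc k} d M diag off = begin
      cofactorTerm M zero + sumFin (cofactorTerm M ∘ suc)
    ≈⟨ +-cong (trans (*-identityˡ _) (*-cong (diag zero) (det-diagonal (d ∘ suc) (minor M zero) (diag ∘ suc)
                                                          (λ a b a≢b → off _ _ (a≢b ∘ FinP.suc-injective)))))
              (Σ-0 (λ j → trans (*-congˡ (trans (*-congʳ (off zero (suc j) (λ ()))) (zeroˡ _))) (zeroʳ _))) ⟩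
      d zero * prodFin (d ∘ suc) + 0#
    ≈⟨ +-identityʳ _ ⟩
      prodFin d ∎

  det-blockTriangular : ∀ a b (M : Mat (a ℕ.+ b)) → (∀ i j → M (i ↑ˡ b) (a ↑ʳ j) ≈ 0#) →
    det M ≈ det (λ i j → M (i ↑ˡ b) (j ↑ˡ b)) * det (λ i j → M (a ↑ʳ i) (a ↑ʳ j))
  det-blockTriangular zero    b M upperRight≈0 = sym (*-identityˡ _)
  det-blockTriangular (suc a) b M upperRight≈0 = begin
      sumFin (cofactorTerm M)
    ≈⟨ Σ-split (suc a) b (cofactorTerm M) ⟩
      sumFin (λ j → cofactorTerm M (j ↑ˡ b)) + sumFin (λ j → cofactorTerm M (suc a ↑ʳ j))
    ≈⟨ +-cong (Σ-cong left) (Σ-0 right) ⟩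
      sumFin (λ j → cofactorTerm TL j * det BR) + 0#
    ≈⟨ +-identityʳ _ ⟩
      sumFin (λ j → cofactorTerm TL j * det BR)
    ≈⟨ Σ-*ʳ (det BR) (cofactorTerm TL) ⟨
      det TL * det BR ∎
    where
    TL : Mat (suc a)
    TL i j = M (i ↑ˡ b) (j ↑ˡ b)
    BR : Mat b
    BR i j = M (suc a ↑ʳ i) (suc a ↑ʳ j)
    punchIn-↑ˡ : ∀ {n} (j : Fin (suc n)) (c : Fin n) → punchIn (j ↑ˡ b) (c ↑ˡ b) ≡ punchIn j c ↑ˡ b
    punchIn-↑ˡ zero    c       = ≡.refl
    punchIn-↑ˡ (suc j) zero    = ≡.refl
    punchIn-↑ˡ (suc j) (suc c) = ≡.cong suc (punchIn-↑ˡ j c)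
    punchIn-↑ʳ : ∀ {n} (j : Fin (suc n)) (c : Fin b) → punchIn (j ↑ˡ b) (n ↑ʳ c) ≡ suc n ↑ʳ c
    punchIn-↑ʳ {n}     zero    c = ≡.refl
    punchIn-↑ʳ {suc n} (suc j) c = ≡.cong suc (punchIn-↑ʳ j c)
    right : ∀ j → cofactorTerm M (suc a ↑ʳ j) ≈ 0#
    right j = trans (*-congˡ (trans (*-congʳ (upperRight≈0 zero j)) (zeroˡ _))) (zeroʳ _)
    left : ∀ j → cofactorTerm M (j ↑ˡ b) ≈ cofactorTerm TL j * det BR
    left j = begin
        sign (toℕ (j ↑ˡ b)) * (M zero (j ↑ˡ b) * det (minor M (j ↑ˡ b)))
      ≈⟨ *-cong (≡⇒≈ (≡.cong sign (FinP.toℕ-↑ˡ j b))) (*-congˡ (trans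
           (det-blockTriangular a b (minor M (j ↑ˡ b))
              (λ i c → trans (≡⇒≈ (≡.cong (M (suc i ↑ˡ b)) (punchIn-↑ʳ j c))) (upperRight≈0 (suc i) c)))
           (*-cong (det-cong (λ i c → ≡⇒≈ (≡.cong (M (suc i ↑ˡ b)) (punchIn-↑ˡ j c))))
                   (det-cong (λ i c → ≡⇒≈ (≡.cong (M (suc a ↑ʳ i)) (punchIn-↑ʳ j c))))))) ⟩
        sign (toℕ j) * (TL zero j * (det (minor TL j) * det BR))
      ≈⟨ solve 4 (λ s x y z → s :* (x :* (y :* z)) := s :* (x :* y) :* z) refl
                 (sign (toℕ j)) (TL zero j) (det (minor TL j)) (det BR) ⟩
        cofactorTerm TL j * det BR ∎

  -- If every column of K sums to σ, then det K = σ · det K' where K' is K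
  -- with row i replaced by ones: first add all other rows to row i.
  ones : ∀ {k} → Fin k → Carrier
  ones _ = 1#

  det-columnSums : ∀ {k} (i : Fin k) (K : Mat k) (σ : Carrier) → (∀ b → sumFin (λ a → K a b) ≈ σ) →
    det K ≈ σ * det (setRow K i ones)
  det-columnSums {suc k} i K σ colSum = begin
      det K
    ≈⟨ det-addRow i cf K K₁ cfᵢ≈0 (λ r r≢i b → setRow-other K _ b r≢i) row ⟨
      det K₁
    ≈⟨ det-linearRow i σ K₁ (setRow K i ones) (setRow K i (λ _ → 0#)) (same ones) (same (λ _ → 0#)) rowσ ⟩
      σ * det (setRow K i ones) + det (setRow K i (λ _ → 0#))
    ≈⟨ +-congˡ (det-zeroRow i (setRow K i (λ _ → 0#)) (setRow-same K i (λ _ → 0#))) ⟩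
      σ * det (setRow K i ones) + 0#
    ≈⟨ +-identityʳ _ ⟩
      σ * det (setRow K i ones) ∎
    where
    colSums : Fin (suc k) → Carrier
    colSums b = sumFin (λ a → K a b)
    K₁ : Mat (suc k)
    K₁ = setRow K i colSums
    cf : Fin (suc k) → Carrier
    cf j = if j == i then 0# else 1#
    cfᵢ≈0 : cf i ≈ 0#
    cfᵢ≈0 = ≡⇒≈ (≡.cong (if_then 0# else 1#) (==-refl i))
    others : ∀ b → sumFin (λ j → cf j * K j b) ≈ sumFin (λ l → K (punchIn i l) b)
    others b = begin
        sumFin (λ j → cf j * K j b)
      ≈⟨ Σ-punch i (λ j → cf j * K j b) ⟩
        cf i * K i b + sumFin (λ l → cf (punchIn i l) * K (punchIn i l) b)
      ≈⟨ +-cong (trans (*-congʳ cfᵢ≈0) (zeroˡ _))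
                (Σ-cong (λ l → trans (*-congʳ (≡⇒≈ (≡.cong (if_then 0# else 1#) (==-false (FinP.punchInᵢ≢i i l)))))
                                     (*-identityˡ _))) ⟩
        0# + sumFin (λ l → K (punchIn i l) b)
      ≈⟨ +-identityˡ _ ⟩
        sumFin (λ l → K (punchIn i l) b) ∎
    row : ∀ b → K₁ i b ≈ K i b + sumFin (λ j → cf j * K j b)
    row b = trans (setRow-same K i colSums b) (trans (Σ-punch i (λ a → K a b)) (+-congˡ (sym (others b))))
    same : ∀ v r → r ≢ i → ∀ b → K₁ r b ≈ setRow K i v r b
    same v r r≢i b = trans (setRow-other K colSums b r≢i) (sym (setRow-other K v b r≢i))
    rowσ : ∀ b → K₁ i b ≈ σ * setRow K i ones i b + setRow K i (λ _ → 0#) i b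
    rowσ b = trans (setRow-same K i colSums b) (trans (colSum b)
               (sym (trans (+-cong (*-congˡ (setRow-same K i ones b)) (setRow-same K i _ b))
                           (trans (+-identityʳ _) (*-identityʳ _)))))

  -- Shifting each row r ≠ i by a constant c r does not change det once
  -- row i consists of ones: subtract c r times row i.
  det-shiftRows : ∀ {k} (i : Fin k) (K : Mat k) (c : Fin k → Carrier) →
    det (setRow (λ r b → K r b + c r) i ones) ≈ det (setRow K i ones)
  det-shiftRows i K c = trans (det-cong entry) (det-addRows src cf N unused fixed)
    where
    N : Mat _
    N = setRow K i ones
    src : Fin _ → Bool
    src j = j == i
    cf : Fin _ → Fin _ → Carrier
    cf r j = if j == i then (if r == i then 0# else c r) else 0#
    unused : ∀ r j → src j ≡ false → cf r j ≈ 0#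
    unused r j srcⱼ rewrite srcⱼ = refl
    fixed : ∀ r j → src r ≡ true → cf r j ≈ 0#
    fixed r j srcᵣ rewrite srcᵣ with j == i
    ... | true  = refl
    ... | false = refl
    entry : ∀ r b → setRow (λ r b → K r b + c r) i ones r b ≈ N r b + sumFin (λ j → cf r j * N j b)
    entry r b with r FinP.≟ i
    ... | yes ≡.refl = sym (trans (+-congˡ (Σ-0 (λ j → trans (*-congʳ (if-same (j == r))) (zeroˡ _))))
                                  (+-identityʳ _))
      where
      if-same : ∀ β → (if β then 0# else 0#) ≈ 0#
      if-same true  = refl
      if-same false = refl
    ... | no r≢i = sym (+-congˡ (trans (Σ-delta i (λ j β → (if β then c r else 0#) * N j b) (λ _ → zeroˡ _))
                                       (trans (*-congˡ (setRow-same K i ones b)) (*-identityʳ _))))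

module BlockMatrices {c ℓ} (R : CommutativeRing c ℓ) where
  open CommutativeRing R hiding (zero)
  open RingDefs R
  open IntegerSolver R using (solve; _:+_; _:*_; :-_; _:=_; con)
  open FiniteSums R
  open Determinants R
  open import Relation.Binary.Reasoning.Setoid setoid

  Block : ℕ → ℕ → Set c
  Block a b = Fin a → Fin b → Carrier

  blockEntry : ∀ {a b} → Block a a → Block a b → Block b a → Block b b →
    Fin a ⊎ Fin b → Fin a ⊎ Fin b → Carrier
  blockEntry A B C Z (inj₁ u) (inj₁ v) = A u v
  blockEntry A B C Z (inj₁ u) (inj₂ f) = B u f
  blockEntry A B C Z (inj₂ e) (inj₁ v) = C e v
  blockEntry A B C Z (inj₂ e) (inj₂ f) = Z e f

  blk : ∀ {a b} → Block a a → Block a b → Block b a → Block b b → Mat (a ℕ.+ b)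
  blk {a} A B C Z r s = blockEntry A B C Z (splitAt a r) (splitAt a s)

  blk-cong : ∀ {a b} {A A' : Block a a} {B B' : Block a b} {C C' : Block b a} {Z Z' : Block b b} →
    (∀ u v → A u v ≈ A' u v) → (∀ u f → B u f ≈ B' u f) → (∀ e v → C e v ≈ C' e v) → (∀ e f → Z e f ≈ Z' e f) →
    ∀ r s → blk A B C Z r s ≈ blk A' B' C' Z' r s
  blk-cong {a} A≈ B≈ C≈ Z≈ r s with splitAt a r | splitAt a s
  ... | inj₁ u | inj₁ v = A≈ u v
  ... | inj₁ u | inj₂ f = B≈ u f
  ... | inj₂ e | inj₁ v = C≈ e v
  ... | inj₂ e | inj₂ f = Z≈ e f

  O : ∀ {a b} → Block a b
  O _ _ = 0#

  blk-join : ∀ {a b} A B C Z (x y : Fin a ⊎ Fin b) → blk A B C Z (join a b x) (join a b y) ≡ blockEntry A B C Z x y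
  blk-join {a} {b} A B C Z x y = ≡.cong₂ (blockEntry A B C Z) (FinP.splitAt-join a b x) (FinP.splitAt-join a b y)

  blockwise : ∀ {a b p} {P : Fin (a ℕ.+ b) → Fin (a ℕ.+ b) → Set p} →
    (∀ x y → P (join a b x) (join a b y)) → ∀ r s → P r s
  blockwise {a} {b} {P = P} h r s = ≡.subst₂ P (FinP.join-splitAt a b r) (FinP.join-splitAt a b s) (h (splitAt a r) (splitAt a s))

  Σ-blocks : ∀ {a b} (F : Fin a ⊎ Fin b → Carrier) →
    sumFin (λ j → F (splitAt a j)) ≈ sumFin (λ v → F (inj₁ v)) + sumFin (λ f → F (inj₂ f))
  Σ-blocks {a} {b} F = trans (Σ-split a b (F ∘ splitAt a))
    (+-cong (Σ-cong (λ v → ≡⇒≈ (≡.cong F (FinP.splitAt-↑ˡ a v b)))) (Σ-cong (λ f → ≡⇒≈ (≡.cong F (FinP.splitAt-↑ʳ a b f)))))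

  Σ-zeroˡ : ∀ {k} (g : Fin k → Carrier) → sumFin (λ j → 0# * g j) ≈ 0#
  Σ-zeroˡ g = Σ-0 (λ j → zeroˡ (g j))

  isUpper : ∀ {a b} → Fin a ⊎ Fin b → Bool
  isUpper (inj₁ _) = true
  isUpper (inj₂ _) = false

  det-addLowerToUpper : ∀ {a b} (K : Block a b) (M : Mat (a ℕ.+ b)) →
    det (λ r s → M r s + sumFin (λ j → blk O K O O r j * M j s)) ≈ det M
  det-addLowerToUpper {a} {b} K M = det-addRows src (blk O K O O) M
    (blockwise {P = λ r j → src j ≡ false → blk O K O O r j ≈ 0#} unused)
    (blockwise {P = λ r j → src r ≡ true → blk O K O O r j ≈ 0#} fixed)
    where
    src : Fin (a ℕ.+ b) → Bool
    src r = not (isUpper (splitAt a r))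
    unused : ∀ x y → src (join a b y) ≡ false → blk O K O O (join a b x) (join a b y) ≈ 0#
    unused x y rewrite FinP.splitAt-join a b x | FinP.splitAt-join a b y with x | y
    ... | inj₁ _ | inj₁ _ = λ _ → refl
    ... | inj₂ _ | inj₁ _ = λ _ → refl
    ... | _      | inj₂ _ = λ ()
    fixed : ∀ x y → src (join a b x) ≡ true → blk O K O O (join a b x) (join a b y) ≈ 0#
    fixed x y rewrite FinP.splitAt-join a b x | FinP.splitAt-join a b y with x | y
    ... | inj₁ _ | _      = λ ()
    ... | inj₂ _ | inj₁ _ = λ _ → refl
    ... | inj₂ _ | inj₂ _ = λ _ → refl

  det-addUpperToLower : ∀ {a b} (L : Block b a) (M : Mat (a ℕ.+ b)) →
    det (λ r s → M r s + sumFin (λ j → blk O O L O r j * M j s)) ≈ det M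
  det-addUpperToLower {a} {b} L M = det-addRows src (blk O O L O) M
    (blockwise {P = λ r j → src j ≡ false → blk O O L O r j ≈ 0#} unused)
    (blockwise {P = λ r j → src r ≡ true → blk O O L O r j ≈ 0#} fixed)
    where
    src : Fin (a ℕ.+ b) → Bool
    src r = isUpper (splitAt a r)
    unused : ∀ x y → src (join a b y) ≡ false → blk O O L O (join a b x) (join a b y) ≈ 0#
    unused x y rewrite FinP.splitAt-join a b x | FinP.splitAt-join a b y with x | y
    ... | _      | inj₁ _ = λ ()
    ... | inj₁ _ | inj₂ _ = λ _ → refl
    ... | inj₂ _ | inj₂ _ = λ _ → refl
    fixed : ∀ x y → src (join a b x) ≡ true → blk O O L O (join a b x) (join a b y) ≈ 0#
    fixed x y rewrite FinP.splitAt-join a b x | FinP.splitAt-join a b y with x | y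
    ... | inj₁ _ | inj₁ _ = λ _ → refl
    ... | inj₁ _ | inj₂ _ = λ _ → refl
    ... | inj₂ _ | _      = λ ()

  det-blockEliminate : ∀ {a b} (A : Block a a) (B : Block a b) (C : Block b a) (Z : Block b b) (L : Block b a) →
    det (blk A B (λ e v → C e v + sumFin (λ u → L e u * A u v)) (λ e f → Z e f + sumFin (λ u → L e u * B u f)))
    ≈ det (blk A B C Z)
  det-blockEliminate {a} {b} A B C Z L =
    trans (det-cong (blockwise {P = λ r s → blk A B C' Z' r s ≈ M r s + sumFin (λ j → blk O O L O r j * M j s)} entry))
          (det-addUpperToLower L M)
    where
    M : Mat (a ℕ.+ b)
    M = blk A B C Z
    C' : Block b a
    C' e v = C e v + sumFin (λ u → L e u * A u v)
    Z' : Block b b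
    Z' e f = Z e f + sumFin (λ u → L e u * B u f)
    entry : ∀ x y → blk A B C' Z' (join a b x) (join a b y)
                    ≈ M (join a b x) (join a b y) + sumFin (λ j → blk O O L O (join a b x) j * M j (join a b y))
    entry x y rewrite FinP.splitAt-join a b x | FinP.splitAt-join a b y =
      trans (cases x y) (+-congˡ (sym (Σ-blocks (λ s → blockEntry O O L O x s * blockEntry A B C Z s y))))
      where
      upperRows : Fin a ⊎ Fin b → Fin a → Carrier
      upperRows y v = blockEntry A B C Z (inj₁ v) y
      lowerRows : Fin a ⊎ Fin b → Fin b → Carrier
      lowerRows y f = blockEntry A B C Z (inj₂ f) y
      unchanged : ∀ p y → p ≈ p + (sumFin (λ v → 0# * upperRows y v) + sumFin (λ f → 0# * lowerRows y f))
      unchanged p y = sym (trans (+-congˡ (trans (+-cong (Σ-zeroˡ (upperRows y)) (Σ-zeroˡ (lowerRows y))) (+-identityʳ 0#)))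
                                 (+-identityʳ p))
      combined : ∀ p q y → p + q ≈ p + (q + sumFin (λ f → 0# * lowerRows y f))
      combined p q y = +-congˡ (sym (trans (+-congˡ (Σ-zeroˡ (lowerRows y))) (+-identityʳ q)))
      cases : ∀ x y → blockEntry A B C' Z' x y ≈ blockEntry A B C Z x y
                      + (sumFin (λ v → blockEntry O O L O x (inj₁ v) * upperRows y v)
                         + sumFin (λ f → blockEntry O O L O x (inj₂ f) * lowerRows y f))
      cases (inj₁ u) y@(inj₁ v) = unchanged (A u v) y
      cases (inj₁ u) y@(inj₂ f) = unchanged (B u f) y
      cases (inj₂ e) y@(inj₁ v) = combined (C e v) _ y
      cases (inj₂ e) y@(inj₂ f) = combined (Z e f) _ y

  scalarMat : ∀ {k} → Carrier → Mat k
  scalarMat y p q = if p == q then y else 0#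

  det-scalar : ∀ {k} (y : Carrier) → det (scalarMat {k} y) ≈ pow y k
  det-scalar {k} y = trans (det-diagonal {k} (λ _ → y) (scalarMat y)
                          (λ a → ≡⇒≈ (≡.cong (if_then y else 0#) (==-refl a)))
                          (λ a b a≢b → ≡⇒≈ (≡.cong (if_then y else 0#) (==-false a≢b))))
                       (Π-const {k} y (λ _ → refl))

  -- Scale the upper rows by y, subtract B · (lower rows) from them, and
  -- expand the resulting block triangular matrix [ yA - BC 0 ; C yI ].
  det-schur : ∀ {a b} (y : Carrier) (A : Block a a) (B : Block a b) (C : Block b a) →
    pow y a * det (blk A B C (scalarMat y)) ≈ pow y b * det (λ v w → y * A v w - sumFin (λ e → B v e * C e w))
  det-schur {a} {b} y A B C = begin
      pow y a * det M
    ≈⟨ *-congʳ scaleProduct ⟨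
      prodFin scale * det M
    ≈⟨ det-scaleRows scale M ⟨
      det M₁
    ≈⟨ det-addLowerToUpper K M₁ ⟨
      det M₂
    ≈⟨ det-cong (blockwise {P = λ r s → M₂ r s ≈ blk S O C D r s} entry) ⟩
      det (blk S O C D)
    ≈⟨ det-blockTriangular a b (blk S O C D) (λ i j → ≡⇒≈ (blk-join S O C D (inj₁ i) (inj₂ j))) ⟩
      det (λ i j → blk S O C D (i ↑ˡ b) (j ↑ˡ b)) * det (λ i j → blk S O C D (a ↑ʳ i) (a ↑ʳ j))
    ≈⟨ *-cong (det-cong (λ i j → ≡⇒≈ (blk-join S O C D (inj₁ i) (inj₁ j))))
              (trans (det-cong (λ i j → ≡⇒≈ (blk-join S O C D (inj₂ i) (inj₂ j)))) (det-scalar {b} y)) ⟩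
      det S * pow y b
    ≈⟨ *-comm _ _ ⟩
      pow y b * det S ∎
    where
    D : Block b b
    D = scalarMat y
    M : Mat (a ℕ.+ b)
    M = blk A B C D
    scaleOf : Fin a ⊎ Fin b → Carrier
    scaleOf (inj₁ _) = y
    scaleOf (inj₂ _) = 1#
    scale : Fin (a ℕ.+ b) → Carrier
    scale r = scaleOf (splitAt a r)
    scaleProduct : prodFin scale ≈ pow y a
    scaleProduct = trans (Π-split a b scale)
      (trans (*-cong (Π-const y (λ v → ≡⇒≈ (≡.cong scaleOf (FinP.splitAt-↑ˡ a v b))))
                     (Π-1 (λ f → ≡⇒≈ (≡.cong scaleOf (FinP.splitAt-↑ʳ a b f)))))
             (*-identityʳ _))
    M₁ : Mat (a ℕ.+ b)
    M₁ r s = scale r * M r s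
    K : Block a b
    K v e = - B v e
    M₂ : Mat (a ℕ.+ b)
    M₂ r s = M₁ r s + sumFin (λ j → blk O K O O r j * M₁ j s)
    S : Block a a
    S v w = y * A v w - sumFin (λ e → B v e * C e w)
    entry : ∀ x y → M₂ (join a b x) (join a b y) ≈ blk S O C D (join a b x) (join a b y)
    entry x z rewrite FinP.splitAt-join a b x | FinP.splitAt-join a b z =
      trans (+-congˡ (Σ-blocks (λ s → blockEntry O K O O x s * (scaleOf s * blockEntry A B C D s z)))) (cases x z)
      where
      cases : ∀ x z → scaleOf x * blockEntry A B C D x z
                        + (sumFin (λ v → blockEntry O K O O x (inj₁ v) * (y * blockEntry A B C D (inj₁ v) z))
                           + sumFin (λ f → blockEntry O K O O x (inj₂ f) * (1# * blockEntry A B C D (inj₂ f) z)))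
                      ≈ blockEntry S O C D x z
      cases (inj₁ v) (inj₁ w) = +-congˡ (begin
          sumFin (λ u → 0# * (y * A u w)) + sumFin (λ e → - B v e * (1# * C e w))
        ≈⟨ +-cong (Σ-zeroˡ (λ u → y * A u w)) (Σ-cong (λ e → solve 2 (λ b c → :- b :* (con (+ 1) :* c) := :- (b :* c)) refl (B v e) (C e w))) ⟩
          0# + sumFin (λ e → - (B v e * C e w))
        ≈⟨ trans (+-identityˡ _) (Σ-neg (λ e → B v e * C e w)) ⟩
          - sumFin (λ e → B v e * C e w) ∎)
      cases (inj₁ v) (inj₂ f) = begin
          y * B v f + (sumFin (λ u → 0# * (y * B u f)) + sumFin (λ e → - B v e * (1# * D e f)))
        ≈⟨ +-congˡ (+-cong (Σ-zeroˡ (λ u → y * B u f)) (Σ-delta f (λ e β → - B v e * (1# * (if β then y else 0#)))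
                                               (λ e → trans (*-congˡ (zeroʳ 1#)) (zeroʳ _)))) ⟩
          y * B v f + (0# + - B v f * (1# * y))
        ≈⟨ solve 2 (λ y b → y :* b :+ (con (+ 0) :+ :- b :* (con (+ 1) :* y)) := con (+ 0)) refl y (B v f) ⟩
          0# ∎
      cases (inj₂ e) (inj₁ w) = trans (+-cong (*-identityˡ _) (+-cong (Σ-zeroˡ (λ u → y * A u w)) (Σ-zeroˡ (λ g → 1# * C g w))))
                                      (trans (+-congˡ (+-identityʳ 0#)) (+-identityʳ _))
      cases (inj₂ e) (inj₂ f) = trans (+-cong (*-identityˡ _) (+-cong (Σ-zeroˡ (λ u → y * B u f)) (Σ-zeroˡ (λ g → 1# * D g f))))
                                      (trans (+-congˡ (+-identityʳ 0#)) (+-identityʳ _))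

module Incidence {c ℓ} (R : CommutativeRing c ℓ) (D : Digraph) where
  open CommutativeRing R hiding (zero)
  open RingDefs R
  open FiniteSums R
  open import Relation.Binary.Reasoning.Setoid setoid

  tailAt headAt : Fin (m D) → Fin (n D) → Carrier
  tailAt e v = fromBool (tl D e == v)
  headAt e v = fromBool (hd D e == v)

  fromℕ-count : ∀ {k} (p : Fin k → Bool) → fromℕ (countFin p) ≈ sumFin (λ e → fromBool (p e))
  fromℕ-count {zero}  p = refl
  fromℕ-count {suc k} p with p zero
  ... | true  = +-congˡ (fromℕ-count (p ∘ suc))
  ... | false = trans (fromℕ-count (p ∘ suc)) (sym (+-identityˡ _))

  anyFin-count : ∀ {k} (q : Fin k → Bool) → (∀ e f → q e ≡ true → q f ≡ true → e ≡ f) →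
    fromBool (anyFin q) ≈ sumFin (λ e → fromBool (q e))
  anyFin-count {zero}  q unique = refl
  anyFin-count {suc k} q unique with q zero in q₀
  ... | true  = sym (trans (+-congˡ (Σ-0 rest)) (+-identityʳ 1#))
    where
    rest : ∀ i → fromBool (q (suc i)) ≈ 0#
    rest i with q (suc i) in qᵢ
    ... | true  with unique zero (suc i) q₀ qᵢ
    ...   | ()
    rest i | false = refl
  ... | false = trans (anyFin-count (q ∘ suc) (λ e f qe qf → FinP.suc-injective (unique (suc e) (suc f) qe qf)))
                      (sym (+-identityˡ _))

  Σ-tailAt : ∀ e → sumFin (tailAt e) ≈ 1#
  Σ-tailAt e = trans (Σ-cong (λ v → ≡⇒≈ (≡.cong fromBool (==-sym (tl D e) v)))) (Σ-delta (tl D e) (λ _ → fromBool) (λ _ → refl))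

  -- u → v in D iff exactly one arc goes from u to v (D is simple)
  adj-count : ∀ u v → fromBool (adj D u v) ≈ sumFin (λ e → tailAt e u * headAt e v)
  adj-count u v = trans (anyFin-count q unique) (Σ-cong (λ e → both (tl D e == u) (hd D e == v)))
    where
    q : Fin (m D) → Bool
    q e = if tl D e == u then hd D e == v else false
    both : ∀ β γ → fromBool (if β then γ else false) ≈ fromBool β * fromBool γ
    both true  γ = sym (*-identityˡ _)
    both false γ = sym (zeroˡ _)
    ends : ∀ e → q e ≡ true → (tl D e ≡ u) × (hd D e ≡ v)
    ends e qₑ with tl D e == u in tailₑ
    ... | true  = ==-sound tailₑ , ==-sound qₑ
    unique : ∀ e f → q e ≡ true → q f ≡ true → e ≡ f
    unique e f qₑ q_f = simple D e f (≡.trans (proj₁ (ends e qₑ)) (≡.sym (proj₁ (ends f q_f))))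
                                     (≡.trans (proj₂ (ends e qₑ)) (≡.sym (proj₂ (ends f q_f))))

  module Regular (r : ℕ) (regular : Regular r D) where

    Σ-outArcs : ∀ v → sumFin (λ e → tailAt e v) ≈ fromℕ r
    Σ-outArcs v = sym (trans (≡⇒≈ (≡.cong fromℕ (≡.sym (proj₁ (regular v))))) (fromℕ-count (λ e → tl D e == v)))

    Σ-inArcs : ∀ v → sumFin (λ e → headAt e v) ≈ fromℕ r
    Σ-inArcs v = sym (trans (≡⇒≈ (≡.cong fromℕ (≡.sym (proj₂ (regular v))))) (fromℕ-count (λ e → hd D e == v)))

    -- m = n r, counting arcs by their tails
    arcCount : fromℕ (m D) ≈ fromℕ (n D) * fromℕ r
    arcCount = begin
      fromℕ (m D)                                  ≈⟨ *-identityʳ _ ⟨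
      fromℕ (m D) * 1#                             ≈⟨ Σ-const {m D} 1# ⟨
      sumFin {m D} (λ _ → 1#)                      ≈⟨ Σ-cong (λ e → sym (Σ-tailAt e)) ⟩
      sumFin (λ e → sumFin (tailAt e))             ≈⟨ Σ-swap tailAt ⟩
      sumFin (λ v → sumFin (λ e → tailAt e v))     ≈⟨ Σ-cong Σ-outArcs ⟩
      sumFin {n D} (λ _ → fromℕ r)                 ≈⟨ Σ-const {n D} (fromℕ r) ⟩
      fromℕ (n D) * fromℕ r                        ∎

    Σ-adjColumn : ∀ w → sumFin (λ v → fromBool (adj D v w)) ≈ fromℕ r
    Σ-adjColumn w = begin
      sumFin (λ v → fromBool (adj D v w))                      ≈⟨ Σ-cong (λ v → adj-count v w) ⟩
      sumFin (λ v → sumFin (λ e → tailAt e v * headAt e w))    ≈⟨ Σ-swap (λ v e → tailAt e v * headAt e w) ⟩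
      sumFin (λ e → sumFin (λ v → tailAt e v * headAt e w))    ≈⟨ Σ-cong (λ e → trans (sym (Σ-*ʳ (headAt e w) (tailAt e)))
                                                                      (trans (*-congʳ (Σ-tailAt e)) (*-identityˡ _))) ⟩
      sumFin (λ e → headAt e w)                                ≈⟨ Σ-inArcs w ⟩
      fromℕ r                                                  ∎

module Reduction {c ℓ} (R : CommutativeRing c ℓ) (D : Digraph) (r : ℕ) (regular : Regular r D)
                 (x : CommutativeRing.Carrier R) where
  open CommutativeRing R hiding (zero)
  open RingDefs R
  open IntegerSolver R using (solve; _:+_; _:*_; :-_; _:-_; _:=_; con)
  open FiniteSums R
  open Determinants R
  open BlockMatrices R
  open Incidence R D
  open Regular r regular
  open import Relation.Binary.Reasoning.Setoid setoid

  y t nn mm rr shift : Carrier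
  y = x + 1#
  t = pow y 2
  nn = fromℕ (n D)
  mm = fromℕ (m D)
  rr = fromℕ r
  shift = y * (rr + 1#) - mm

  charMatrix : ∀ {k} → (Fin k → Fin k → Bool) → Carrier → Mat k
  charMatrix G z a b = (if a == b then z else 0#) - fromBool (G a b)

  A₁ : Block (n D) (n D)
  A₁ u v = scalarMat y u v - 1#
  B₁ : Block (n D) (m D)
  B₁ v e = - tailAt e v
  C₁ : Block (m D) (n D)
  C₁ e v = - headAt e v
  Z₁ : Block (m D) (m D)
  Z₁ e f = scalarMat y e f - 1#

  adj11Block : Fin (n D) ⊎ Fin (m D) → Fin (n D) ⊎ Fin (m D) → Bool
  adj11Block (inj₁ u) (inj₁ v) = not (u == v)
  adj11Block (inj₂ p) (inj₂ q) = not (p == q)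
  adj11Block (inj₁ v) (inj₂ e) = tl D e == v
  adj11Block (inj₂ e) (inj₁ v) = hd D e == v

  adj11-blocks : ∀ a b → adj11 D a b ≡ adj11Block (splitAt (n D) a) (splitAt (n D) b)
  adj11-blocks a b with splitAt (n D) a | splitAt (n D) b
  ... | inj₁ u | inj₁ v = ≡.refl
  ... | inj₂ p | inj₂ q = ≡.refl
  ... | inj₁ v | inj₂ e = ≡.refl
  ... | inj₂ e | inj₁ v = ≡.refl

  charMatrix11-blocks : ∀ a b → charMatrix (adj11 D) x a b ≈ blk A₁ B₁ C₁ Z₁ a b
  charMatrix11-blocks = blockwise {P = λ a b → charMatrix (adj11 D) x a b ≈ blk A₁ B₁ C₁ Z₁ a b} entry
    where
    diagonal : ∀ β → (if β then x else 0#) - fromBool (not β) ≈ (if β then y else 0#) - 1#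
    diagonal true  = solve 1 (λ x → x :- con (+ 0) := (x :+ con (+ 1)) :- con (+ 1)) refl x
    diagonal false = refl
    offDiagonal : ∀ β → 0# - fromBool β ≈ - fromBool β
    offDiagonal β = +-identityˡ _
    cases : ∀ p q → (if join (n D) (m D) p == join (n D) (m D) q then x else 0#) - fromBool (adj11Block p q)
                    ≈ blockEntry A₁ B₁ C₁ Z₁ p q
    cases (inj₁ u) (inj₁ v) rewrite ==-injective (_↑ˡ m D) (λ {a} {b} → FinP.↑ˡ-injective (m D) a b) u v = diagonal (u == v)
    cases (inj₂ e) (inj₂ f) rewrite ==-injective (n D ↑ʳ_) (λ {a} {b} → FinP.↑ʳ-injective (n D) a b) e f = diagonal (e == f)
    cases (inj₁ v) (inj₂ e) rewrite ==-false (↑ˡ≢↑ʳ v e) = offDiagonal (tl D e == v)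
    cases (inj₂ e) (inj₁ v) rewrite ==-false (↑ˡ≢↑ʳ v e ∘ ≡.sym) = offDiagonal (hd D e == v)
    entry : ∀ p q → charMatrix (adj11 D) x (join (n D) (m D) p) (join (n D) (m D) q)
                    ≈ blk A₁ B₁ C₁ Z₁ (join (n D) (m D) p) (join (n D) (m D) q)
    entry p q rewrite adj11-blocks (join (n D) (m D) p) (join (n D) (m D) q)
                    | FinP.splitAt-join (n D) (m D) p | FinP.splitAt-join (n D) (m D) q = cases p q

  -- Subtracting all vertex rows from every arc row turns the arc-arc
  -- block into yI, since every arc has exactly one tail.
  C₂ : Block (m D) (n D)
  C₂ e v = C₁ e v + sumFin (λ u → - 1# * A₁ u v)

  eliminate : det (blk A₁ B₁ C₁ Z₁) ≈ det (blk A₁ B₁ C₂ (scalarMat y))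
  eliminate = trans (sym (det-blockEliminate A₁ B₁ C₁ Z₁ (λ _ _ → - 1#)))
                    (det-cong (blk-cong {A = A₁} {B = B₁} {C = C₂} (λ _ _ → refl) (λ _ _ → refl) (λ _ _ → refl) arcBlock))
    where
    arcBlock : ∀ e f → Z₁ e f + sumFin (λ u → - 1# * B₁ u f) ≈ scalarMat y e f
    arcBlock e f = begin
        (scalarMat y e f - 1#) + sumFin (λ u → - 1# * - tailAt f u)
      ≈⟨ +-congˡ (trans (Σ-cong (λ u → solve 1 (λ a → :- con (+ 1) :* (:- a) := a) refl (tailAt f u))) (Σ-tailAt f)) ⟩
        (scalarMat y e f - 1#) + 1#
      ≈⟨ solve 1 (λ s → (s :- con (+ 1)) :+ con (+ 1) := s) refl (scalarMat y e f) ⟩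
        scalarMat y e f ∎

  schurComplement : Block (n D) (n D)
  schurComplement v w = y * A₁ v w - sumFin (λ e → B₁ v e * C₂ e w)

  reduceToSchur : pow y (n D) * det (charMatrix (adj11 D) x) ≈ pow y (m D) * det schurComplement
  reduceToSchur = begin
    pow y (n D) * det (charMatrix (adj11 D) x)        ≈⟨ *-congˡ (det-cong charMatrix11-blocks) ⟩
    pow y (n D) * det (blk A₁ B₁ C₁ Z₁)               ≈⟨ *-congˡ eliminate ⟩
    pow y (n D) * det (blk A₁ B₁ C₂ (scalarMat y))    ≈⟨ det-schur y A₁ B₁ C₂ ⟩
    pow y (m D) * det schurComplement                 ∎

  schurComplement≈ : ∀ v w → schurComplement v w ≈ charMatrix (adj D) t v w - shift
  schurComplement≈ v w = begin
      y * A₁ v w - sumFin (λ e → B₁ v e * C₂ e w)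
    ≈⟨ +-congˡ (-‿cong arcSum) ⟩
      y * (scalarMat y v w - 1#) - (a - (nn - y) * rr)
    ≈⟨ solve 6 (λ y s a n r m → y :* (s :- con (+ 1)) :- (a :- (n :- y) :* r)
                               := y :* s :- a :- (y :* (r :+ con (+ 1)) :- n :* r)) refl y (scalarMat y v w) a nn rr mm ⟩
      y * scalarMat y v w - a - (y * (rr + 1#) - nn * rr)
    ≈⟨ +-cong (+-congʳ squareDiagonal) (-‿cong (+-congˡ (-‿cong (sym arcCount)))) ⟩
      charMatrix (adj D) t v w - shift ∎
    where
    a : Carrier
    a = fromBool (adj D v w)
    squareDiagonal : y * scalarMat y v w ≈ scalarMat t v w
    squareDiagonal with v == w
    ... | true  = *-congˡ (sym (*-identityʳ y))
    ... | false = zeroʳ y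
    vertexColumn : sumFin (λ u → - 1# * A₁ u w) ≈ nn - y
    vertexColumn = begin
        sumFin (λ u → - 1# * (scalarMat y u w - 1#))
      ≈⟨ Σ-cong (λ u → solve 1 (λ s → :- con (+ 1) :* (s :- con (+ 1)) := con (+ 1) :+ :- s) refl (scalarMat y u w)) ⟩
        sumFin (λ u → 1# + - scalarMat y u w)
      ≈⟨ Σ-+ (λ _ → 1#) (λ u → - scalarMat y u w) ⟩
        sumFin {n D} (λ _ → 1#) + sumFin (λ u → - scalarMat y u w)
      ≈⟨ +-cong (trans (Σ-const {n D} 1#) (*-identityʳ nn))
                (trans (Σ-neg (λ u → scalarMat y u w)) (-‿cong (Σ-delta w (λ _ β → if β then y else 0#) (λ _ → refl)))) ⟩
        nn - y ∎
    arcSum : sumFin (λ e → B₁ v e * C₂ e w) ≈ a - (nn - y) * rr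
    arcSum = begin
        sumFin (λ e → - tailAt e v * (- headAt e w + sumFin (λ u → - 1# * A₁ u w)))
      ≈⟨ Σ-cong {f = λ e → B₁ v e * C₂ e w} (λ e → *-congˡ (+-congˡ vertexColumn)) ⟩
        sumFin (λ e → - tailAt e v * (- headAt e w + (nn - y)))
      ≈⟨ Σ-cong (λ e → solve 3 (λ τ h κ → :- τ :* (:- h :+ κ) := τ :* h :+ :- κ :* τ) refl (tailAt e v) (headAt e w) (nn - y)) ⟩
        sumFin (λ e → tailAt e v * headAt e w + - (nn - y) * tailAt e v)
      ≈⟨ Σ-+ (λ e → tailAt e v * headAt e w) (λ e → - (nn - y) * tailAt e v) ⟩
        sumFin (λ e → tailAt e v * headAt e w) + sumFin (λ e → - (nn - y) * tailAt e v)
      ≈⟨ +-cong (sym (adj-count v w)) (trans (sym (Σ-*ˡ (- (nn - y)) (λ e → tailAt e v))) (*-congˡ (Σ-outArcs v))) ⟩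
        a + - (nn - y) * rr
      ≈⟨ solve 3 (λ a κ r → a :+ :- κ :* r := a :- κ :* r) refl a (nn - y) rr ⟩
        a - (nn - y) * rr ∎

  Σ-charColumn : ∀ w → sumFin (λ v → charMatrix (adj D) t v w) ≈ t - rr
  Σ-charColumn w = begin
      sumFin (λ v → scalarMat t v w - fromBool (adj D v w))
    ≈⟨ Σ-+ (λ v → scalarMat t v w) (λ v → - fromBool (adj D v w)) ⟩
      sumFin (λ v → scalarMat t v w) + sumFin (λ v → - fromBool (adj D v w))
    ≈⟨ +-cong (Σ-delta w (λ _ β → if β then t else 0#) (λ _ → refl))
              (trans (Σ-neg (λ v → fromBool (adj D v w))) (-‿cong (Σ-adjColumn w))) ⟩
      t - rr ∎

  Σ-shiftedColumn : ∀ w → sumFin (λ v → charMatrix (adj D) t v w - shift) ≈ (t - rr) - nn * shift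
  Σ-shiftedColumn w = begin
      sumFin (λ v → charMatrix (adj D) t v w - shift)
    ≈⟨ Σ-+ (λ v → charMatrix (adj D) t v w) (λ _ → - shift) ⟩
      sumFin (λ v → charMatrix (adj D) t v w) + sumFin {n D} (λ _ → - shift)
    ≈⟨ +-cong (Σ-charColumn w) (Σ-const {n D} (- shift)) ⟩
      (t - rr) + nn * - shift
    ≈⟨ solve 3 (λ σ n c → σ :+ n :* (:- c) := σ :- n :* c) refl (t - rr) nn shift ⟩
      (t - rr) - nn * shift ∎

theorem5p1 : ∀ {c ℓ : Level} (R : CommutativeRing c ℓ) (D : Digraph) (r : ℕ) →
  Regular r D → (x : CommutativeRing.Carrier R) →
  let open CommutativeRing R
      open RingDefs R
      y = x + 1#
      nn = fromℕ (n D)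
      mm = fromℕ (m D)
      rr = fromℕ r
  in (pow y (n D) * (pow y 2 - rr)) * charPoly (adj11 D) x
     ≈ (pow y (m D) * ((pow y 2 - rr) - nn * (y * (rr + 1#) - mm))) * charPoly (adj D) (pow y 2)
theorem5p1 R D r regular x = begin
    (pow y (n D) * (t - rr)) * det (charMatrix (adj11 D) x)
  ≈⟨ solve 3 (λ p s d → (p :* s) :* d := s :* (p :* d)) refl (pow y (n D)) (t - rr) (det (charMatrix (adj11 D) x)) ⟩
    (t - rr) * (pow y (n D) * det (charMatrix (adj11 D) x))
  ≈⟨ *-congˡ (trans reduceToSchur (*-congˡ (det-cong schurComplement≈))) ⟩
    (t - rr) * (pow y (m D) * det S)
  ≈⟨ *-congˡ (*-congˡ (det-columnSums i₀ S σ Σ-shiftedColumn)) ⟩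
    (t - rr) * (pow y (m D) * (σ * X))
  ≈⟨ solve 4 (λ s p σ X → s :* (p :* (σ :* X)) := (p :* σ) :* (s :* X)) refl (t - rr) (pow y (m D)) σ X ⟩
    (pow y (m D) * σ) * ((t - rr) * X)
  ≈⟨ *-congˡ (*-congˡ sameX) ⟩
    (pow y (m D) * σ) * ((t - rr) * det (setRow B i₀ ones))
  ≈⟨ *-congˡ (det-columnSums i₀ B (t - rr) Σ-charColumn) ⟨
    (pow y (m D) * σ) * det B ∎
  where
  open CommutativeRing R
  open RingDefs R
  open IntegerSolver R using (solve; _:*_; _:=_)
  open Determinants R
  open Reduction R D r regular x
  open import Relation.Binary.Reasoning.Setoid setoid
  i₀ : Fin (n D)
  i₀ = fromℕ< (nonempty D)
  B S : Mat (n D)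
  B = charMatrix (adj D) t
  S v w = B v w - shift
  σ X : Carrier
  σ = (t - rr) - nn * shift
  X = det (setRow S i₀ ones)
  -- B is S + c J, and the shift disappears once a row is all ones
  sameX : X ≈ det (setRow B i₀ ones)
  sameX = sym (trans (det-cong (setRow-cong i₀ ones unshift)) (det-shiftRows i₀ S (λ _ → shift)))
    where
    unshift : ∀ v w → B v w ≈ S v w + shift
    unshift v w = sym (trans (+-assoc _ _ _) (trans (+-congˡ (-‿inverseˡ shift)) (+-identityʳ _)))
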